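{- Let $k>l>0$ be integers, $m:=\gcd(k,l)$, $k_1:=k/m$, $l_1:=l/m$, $\omega=e^{\pi i/3}$, $z=k+l\omega$, and let $\triangle$ be the triangle in $\mathbb{C}$ with vertices $0,z,\omega z$. An edge (side) of $\triangle$ passes through the barycenter of some small triangle of the triangular lattice $\mathbb{Z}[\omega]$ if and only if $k_1\not\equiv 0\pmod 3$ and $k_1\equiv l_1\pmod 3$. Moreover, in this case each side of $\triangle$ passes through exactly $2m$ such barycenters; among these $2m$ barycenters exactly $m$ are barycenters of upward small triangles, each of which has exactly two edge-adjacent small triangles whose barycenters lie in $\triangle$; and the resulting $3m$ barycenters of upward triangles on the three sides of $\triangle$ are invariant under the rotation by $2\pi/3$ about the center of $\triangle$.
   Context: The small triangles of $\mathbb{Z}[\omega]$ are the upward triangles with vertices $a+b\omega,\ a+1+b\omega,\ a+(b+1)\omega$ and the downward triangles with vertices $a+b\omega,\ a+(b+1)\omega,\ a-1+(b+1)\omega$, for $a,b\in\mathbb{Z}$. Two small triangles are edge-adjacent if they share an edge. -}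

module Defs where

open import Data.Nat as ℕ using (ℕ; _<_; _≤_)
open import Data.Integer as ℤ using (ℤ; +_; _+_; _*_; -_; _-_)
open import Data.Product using (Σ; _×_; _,_)
open import Data.Sum using (_⊎_)
open import Data.Fin using (Fin; zero; suc)
open import Data.Unit using (⊤)
open import Data.Empty using (⊥)
open import Data.List using (List; length)
open import Data.List.Membership.Propositional using (_∈_)
open import Data.List.Relation.Unary.Unique.Propositional using (Unique)
open import Relation.Binary.PropositionalEquality using (_≡_; _≢_)
open import Function.Bundles using (_⇔_)

-- Elements of ℤ[ω] (ω = e^{πi/3}, so ω² = ω - 1): (a , b) stands for a + bω.
ℤω : Set
ℤω = ℤ × ℤ

infixl 6 _+ω_ _-ω_
infixl 7 _*ω_ _·ω_

_+ω_ : ℤω → ℤω → ℤω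
(a , b) +ω (c , d) = (a + c , b + d)

_-ω_ : ℤω → ℤω → ℤω
(a , b) -ω (c , d) = (a - c , b - d)

-- (a + bω)(c + dω) = ac + (ad + bc)ω + bd ω² , with ω² = ω - 1
_*ω_ : ℤω → ℤω → ℤω
(a , b) *ω (c , d) = (a * c - b * d , a * d + b * c + b * d)

_·ω_ : ℤ → ℤω → ℤω
n ·ω (a , b) = (n * a , n * b)

0ω : ℤω
0ω = (+ 0 , + 0)

ω : ℤω
ω = (+ 0 , + 1)

data SmallTri : Set where
  up   : ℤ → ℤ → SmallTri
  down : ℤ → ℤ → SmallTri

IsUp : SmallTri → Set
IsUp (up _ _)   = ⊤
IsUp (down _ _) = ⊥

vertex : SmallTri → Fin 3 → ℤω
vertex (up a b) zero             = (a , b)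
vertex (up a b) (suc zero)       = (a + + 1 , b)
vertex (up a b) (suc (suc zero)) = (a , b + + 1)
vertex (down a b) zero             = (a , b)
vertex (down a b) (suc zero)       = (a , b + + 1)
vertex (down a b) (suc (suc zero)) = (a - + 1 , b + + 1)

IsVertex : ℤω → SmallTri → Set
IsVertex p T = Σ (Fin 3) λ j → vertex T j ≡ p

EdgeAdjacent : SmallTri → SmallTri → Set
EdgeAdjacent T S = T ≢ S × Σ ℤω λ p → Σ ℤω λ q →
  p ≢ q × IsVertex p T × IsVertex q T × IsVertex p S × IsVertex q S

-- CONVENTION: all geometric points below are represented by 3 times the point,
-- as an element of ℤ[ω].
bary3 : SmallTri → ℤω
bary3 T = vertex T zero +ω vertex T (suc zero) +ω vertex T (suc (suc zero))

OnSegment : ℤω → ℤω → ℤω → Set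
OnSegment A B P = Σ ℕ λ n → Σ ℕ λ s →
  0 < n × s ≤ n × (+ n) ·ω (P -ω A) ≡ (+ s) ·ω (B -ω A)

InTriangle : ℤω → ℤω → ℤω → ℤω → Set
InTriangle A B C P = Σ ℕ λ x → Σ ℕ λ y → Σ ℕ λ w →
  0 < x ℕ.+ y ℕ.+ w ×
  (+ (x ℕ.+ y ℕ.+ w)) ·ω P ≡ (+ x) ·ω A +ω (+ y) ·ω B +ω (+ w) ·ω C

zω : ℕ → ℕ → ℤω
zω k l = (+ k , + l)

corner : ℕ → ℕ → Fin 3 → ℤω
corner k l zero             = 0ω
corner k l (suc zero)       = zω k l
corner k l (suc (suc zero)) = ω *ω zω k l

corner3 : ℕ → ℕ → Fin 3 → ℤω
corner3 k l i = (+ 3) ·ω corner k l i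

next : Fin 3 → Fin 3
next zero             = suc zero
next (suc zero)       = suc (suc zero)
next (suc (suc zero)) = zero

OnSide : ℕ → ℕ → Fin 3 → ℤω → Set
OnSide k l i P = OnSegment (corner3 k l i) (corner3 k l (next i)) P

InTri : ℕ → ℕ → ℤω → Set
InTri k l P = InTriangle (corner3 k l zero) (corner3 k l (suc zero))
                         (corner3 k l (suc (suc zero))) P

-- rotation by 2π/3 about the center c = (0 + z + ωz)/3 of △:
-- ρ(P) = c + ω² (P - c); on encodings 3ρ(P) = 3c + ω²(3P - 3c), 3c = z + ωz.
center3 : ℕ → ℕ → ℤω
center3 k l = zω k l +ω ω *ω zω k l

rot3 : ℕ → ℕ → ℤω → ℤω
rot3 k l P = center3 k l +ω (ω *ω ω) *ω (P -ω center3 k l)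

HasExactly : {A : Set} → ℕ → (A → Set) → Set
HasExactly {A} n P = Σ (List A) λ xs →
  length xs ≡ n × Unique xs × ((x : A) → (x ∈ xs ⇔ P x))

UpBaryOnBoundary : ℕ → ℕ → ℤω → Set
UpBaryOnBoundary k l P = Σ SmallTri λ T →
  IsUp T × bary3 T ≡ P × Σ (Fin 3) λ i → OnSide k l i P

-- Everything is encoded at three times its size, so that barycentres of small triangles are lattice
-- points: the encoded barycentre of an upward (downward) triangle is a point (X , Y) with
-- X ≡ Y ≡ 1 (resp. 2) mod 3, and every such point is one.  The base of △ runs from 0 to
-- 3z = 3m•(k₁ , l₁); since k₁ and l₁ are coprime its lattice points are the j•(k₁ , l₁), 0 ≤ j ≤ 3m.
-- Such a point is a barycentre iff j k₁ ≡ j l₁ ≢ 0 (mod 3), i.e. iff 3 ∤ j, 3 ∤ k₁ and k₁ ≡ l₁;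
-- as k₁² ≡ 1 it is then upward iff j ≡ k₁, which leaves m upward and m downward barycentres.
-- The edge-neighbours of an upward triangle are three downward triangles whose barycentres are its own
-- shifted by (1 , 1), (-2 , 1) and (1 , -2); computing barycentric coordinates by cross products, for
-- 0 < j < 3m the first two lie in △ and the third does not.  The rotation by 2π/3 about the centre of △
-- maps the lattice, the small triangles and △ to themselves and side i to side i + 1, which carries all
-- of this to the other two sides; two sides meet only in a corner, which is not a barycentre.

module Submission where

open import Defs
open import Data.Empty using (⊥; ⊥-elim)
open import Data.Fin using (Fin; zero; suc)
import Data.Fin.Properties as Fin
open import Data.Integer as ℤ using (ℤ; +_; -[1+_]; 0ℤ; ∣_∣; +≤+; +<+)
import Data.Integer.Properties as ℤ
open import Data.Integer.Tactic.RingSolver using (solve-∀; solve)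
open import Data.List using ([]; _∷_; _++_; map; upTo)
open import Data.List.Membership.Propositional using (_∈_)
open import Data.List.Membership.Propositional.Properties using (∈-map⁺; ∈-map⁻; ∈-upTo⁺; ∈-upTo⁻; ∈-++⁺ˡ; ∈-++⁺ʳ; ∈-++⁻)
open import Data.List.Properties using (length-map; length-++; length-upTo)
open import Data.List.Relation.Unary.Any using (here; there)
import Data.List.Relation.Unary.Unique.Propositional.Properties as Unique
open import Data.Nat as ℕ using (ℕ; zero; suc; z≤n; s≤s)
open import Data.Nat.Coprimality using (Coprime; coprime-divisor; gcd≡1⇒coprime)
open import Data.Nat.DivMod using (m≡m%n+[m/n]*n; m%n<n; m%n%n≡m%n; m*n%n≡0; [m+kn]%n≡m%n; m<n⇒m%n≡m; %-distribˡ-*)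
open import Data.Nat.Divisibility using (_∣_; divides)
open import Data.Nat.GCD using (gcd; gcd[m,n]≢0; c*gcd[m,n]≡gcd[cm,cn])
import Data.Nat.Properties as ℕ
open import Algebra.Properties.CommutativeSemigroup ℕ.*-commutativeSemigroup using (x∙yz≈y∙xz; xy∙z≈xz∙y)
open import Data.Product using (Σ; _×_; _,_; proj₁; proj₂)
open import Data.Product.Properties using (≡-dec)
open import Data.Sum using (_⊎_; inj₁; inj₂)
open import Data.Unit using (⊤; tt)
open import Function using (_∘_; id)
open import Function.Bundles using (_⇔_; mk⇔; Equivalence)
open import Relation.Binary.Definitions using (DecidableEquality)
open import Relation.Binary.PropositionalEquality
  using (_≡_; _≢_; refl; sym; trans; cong; cong₂; subst; subst₂; module ≡-Reasoning)
open import Relation.Nullary using (¬_)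
open import Relation.Nullary.Decidable using (Dec; toWitness; ¬?; _×-dec_; _→-dec_; _⊎-dec_)

open Equivalence using (to; from)

-- Counting

module _ where
  open import Data.Nat using (_+_; _<_)

  module _ {A : Set} where

    HasExactly-cong : ∀ {n} {P Q : A → Set} → (∀ x → P x ⇔ Q x) → HasExactly n P → HasExactly n Q
    HasExactly-cong P⇔Q (xs , len , unique , mem) =
      xs , len , unique , λ x → mk⇔ (to (P⇔Q x) ∘ to (mem x)) (from (mem x) ∘ from (P⇔Q x))

    HasExactly-⊎ : ∀ {m n} {P Q : A → Set} → (∀ x → P x → ¬ Q x) →
      HasExactly m P → HasExactly n Q → HasExactly (m + n) (λ x → P x ⊎ Q x)
    HasExactly-⊎ {P = P} {Q} disjoint (xs , refl , uxs , memP) (ys , refl , uys , memQ) =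
      xs ++ ys , length-++ xs , Unique.++⁺ uxs uys apart , λ x → mk⇔ (sort x ∘ ∈-++⁻ xs) (place x)
      where
      apart : ∀ {x} → ¬ (x ∈ xs × x ∈ ys)
      apart {x} (x∈xs , x∈ys) = disjoint x (to (memP x) x∈xs) (to (memQ x) x∈ys)
      sort : ∀ x → x ∈ xs ⊎ x ∈ ys → P x ⊎ Q x
      sort x (inj₁ x∈xs) = inj₁ (to (memP x) x∈xs)
      sort x (inj₂ x∈ys) = inj₂ (to (memQ x) x∈ys)
      place : ∀ x → P x ⊎ Q x → x ∈ xs ++ ys
      place x (inj₁ p) = ∈-++⁺ˡ (from (memP x) p)
      place x (inj₂ q) = ∈-++⁺ʳ xs (from (memQ x) q)

    HasExactly-image : (f : ℕ → A) → (∀ {s t} → f s ≡ f t → s ≡ t) →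
      ∀ n → HasExactly n (λ x → Σ ℕ λ s → s < n × f s ≡ x)
    HasExactly-image f f-injective n =
      map f (upTo n) , trans (length-map f (upTo n)) (length-upTo n) ,
      Unique.map⁺ f-injective (Unique.upTo⁺ n) , λ x → mk⇔ preimage image
      where
      preimage : ∀ {x} → x ∈ map f (upTo n) → Σ ℕ λ s → s < n × f s ≡ x
      preimage x∈ = let s , s∈ , x≡ = ∈-map⁻ f x∈ in s , ∈-upTo⁻ s∈ , sym x≡
      image : ∀ {x} → (Σ ℕ λ s → s < n × f s ≡ x) → x ∈ map f (upTo n)
      image (s , s<n , refl) = ∈-map⁺ f (∈-upTo⁺ s<n)

    HasExactly-transport : ∀ {B : Set} {n} {P : A → Set} {Q : B → Set} (f : A → B) (g : B → A) →
      (∀ x → g (f x) ≡ x) → (∀ y → f (g y) ≡ y) →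
      (∀ x → P x → Q (f x)) → (∀ y → Q y → P (g y)) →
      HasExactly n P → HasExactly n Q
    HasExactly-transport {Q = Q} f g g∘f f∘g P⇒Q Q⇒P (xs , len , unique , mem) =
      map f xs , trans (length-map f xs) len , Unique.map⁺ f-injective unique ,
      λ y → mk⇔ (forward y) (backward y)
      where
      f-injective : ∀ {x x′} → f x ≡ f x′ → x ≡ x′
      f-injective {x} {x′} eq = trans (sym (g∘f x)) (trans (cong g eq) (g∘f x′))
      forward : ∀ y → y ∈ map f xs → Q y
      forward y y∈ = let x , x∈ , y≡ = ∈-map⁻ f y∈ in subst Q (sym y≡) (P⇒Q x (to (mem x) x∈))
      backward : ∀ y → Q y → y ∈ map f xs
      backward y q = subst (_∈ map f xs) (f∘g y) (∈-map⁺ f (from (mem (g y)) (Q⇒P y q)))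

-- Arithmetic modulo 3

module _ where
  open import Data.Nat using (_+_; _*_; _<_; _≤_; _%_; _/_)

  %3-square≡1 : ∀ c → c % 3 ≢ 0 → (c * c) % 3 ≡ 1
  %3-square≡1 c c≢0 = trans (%-distribˡ-* c c 3) (table (c % 3) (m%n<n c 3) c≢0)
    where
    table : ∀ r → r < 3 → r ≢ 0 → (r * r) % 3 ≡ 1
    table 0 _ 0≢0 = ⊥-elim (0≢0 refl)
    table 1 _ _ = refl
    table 2 _ _ = refl
    table (suc (suc (suc _))) (s≤s (s≤s (s≤s ()))) _

  %3-absorbˡ : ∀ m n → ((m % 3) * n) % 3 ≡ (m * n) % 3
  %3-absorbˡ m n = begin
    ((m % 3) * n) % 3           ≡⟨ %-distribˡ-* (m % 3) n 3 ⟩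
    ((m % 3 % 3) * (n % 3)) % 3 ≡⟨ cong (λ t → (t * (n % 3)) % 3) (m%n%n≡m%n m 3) ⟩
    ((m % 3) * (n % 3)) % 3     ≡⟨ %-distribˡ-* m n 3 ⟨
    (m * n) % 3                 ∎
    where open ≡-Reasoning

  *-square-%3 : ∀ x c → c % 3 ≢ 0 → (x * c * c) % 3 ≡ x % 3
  *-square-%3 x c c≢0 = begin
    (x * c * c) % 3               ≡⟨ cong (_% 3) (ℕ.*-assoc x c c) ⟩
    (x * (c * c)) % 3             ≡⟨ %-distribˡ-* x (c * c) 3 ⟩
    ((x % 3) * ((c * c) % 3)) % 3 ≡⟨ cong (λ t → ((x % 3) * t) % 3) (%3-square≡1 c c≢0) ⟩
    ((x % 3) * 1) % 3             ≡⟨ cong (_% 3) (ℕ.*-identityʳ (x % 3)) ⟩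
    x % 3 % 3                     ≡⟨ m%n%n≡m%n x 3 ⟩
    x % 3                         ∎
    where open ≡-Reasoning

  -- As c² ≡ 1 (mod 3), multiplication by c is an involution on residues.
  %3-swap : ∀ {x y c} → c % 3 ≢ 0 → (x * c) % 3 ≡ y % 3 → x % 3 ≡ (y * c) % 3
  %3-swap {x} {y} {c} c≢0 eq = begin
    x % 3                 ≡⟨ *-square-%3 x c c≢0 ⟨
    (x * c * c) % 3       ≡⟨ %3-absorbˡ (x * c) c ⟨
    ((x * c) % 3 * c) % 3 ≡⟨ cong (λ t → (t * c) % 3) eq ⟩
    ((y % 3) * c) % 3     ≡⟨ %3-absorbˡ y c ⟩
    (y * c) % 3           ∎
    where open ≡-Reasoning

  *-%3-congʳ : ∀ j {k l} → k % 3 ≡ l % 3 → (j * k) % 3 ≡ (j * l) % 3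
  *-%3-congʳ j {k} {l} eq =
    trans (%-distribˡ-* j k 3) (trans (cong (λ t → ((j % 3) * t) % 3) eq) (sym (%-distribˡ-* j l 3)))

  [3*s+c]%3≡c : ∀ s {c} → c < 3 → (3 * s + c) % 3 ≡ c
  [3*s+c]%3≡c s {c} c<3 = begin
    (3 * s + c) % 3 ≡⟨ cong (_% 3) (trans (ℕ.+-comm (3 * s) c) (cong (λ t → c + t) (ℕ.*-comm 3 s))) ⟩
    (c + s * 3) % 3 ≡⟨ [m+kn]%n≡m%n c s 3 ⟩
    c % 3           ≡⟨ m<n⇒m%n≡m c<3 ⟩
    c               ∎
    where open ≡-Reasoning

  m≡3*[m/3]+m%3 : ∀ j → j ≡ 3 * (j / 3) + j % 3
  m≡3*[m/3]+m%3 j = trans (m≡m%n+[m/n]*n j 3) (trans (ℕ.+-comm (j % 3) _) (cong (_+ j % 3) (ℕ.*-comm (j / 3) 3)))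

  3*s+c<3*m⇔s<m : ∀ {s c m} → c < 3 → 3 * s + c < 3 * m ⇔ s < m
  3*s+c<3*m⇔s<m {s} {c} {m} c<3 = mk⇔
    (λ lt → ℕ.*-cancelˡ-< 3 s m (ℕ.≤-<-trans (ℕ.m≤m+n (3 * s) c) lt))
    (λ s<m → ℕ.<-≤-trans (ℕ.+-monoʳ-< (3 * s) c<3)
               (subst (_≤ 3 * m) (trans (ℕ.*-suc 3 s) (ℕ.+-comm 3 (3 * s))) (ℕ.*-monoʳ-≤ 3 s<m)))

-- Lattice points on a segment from the origin

module _ where
  open import Data.Nat using (_+_; _*_; _<_; _≤_)

  positive-multiple⇒ℕ : ∀ {n i t} → 0 < n → + n ℤ.* i ≡ + t → Σ ℕ λ q → i ≡ + q × n * q ≡ t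
  positive-multiple⇒ℕ {n} {+ q} _ eq = q , refl , ℤ.+-injective (trans (ℤ.pos-* n q) eq)
  positive-multiple⇒ℕ {suc n} { -[1+ q ]} _ ()

  coprime-ray : ∀ {k₁ l₁ n t p₁ p₂} → Coprime k₁ l₁ → 0 < k₁ → 0 < n →
    n * p₁ ≡ t * k₁ → n * p₂ ≡ t * l₁ → Σ ℕ λ j → p₁ ≡ j * k₁ × p₂ ≡ j * l₁ × n * j ≡ t
  coprime-ray {k₁} {l₁} {n} {t} {p₁} {p₂} coprime 0<k₁ 0<n np₁ np₂ = j , p₁≡ , p₂≡ , nj≡t
    where
    open ≡-Reasoning
    cross-multiplied : p₁ * l₁ ≡ p₂ * k₁
    cross-multiplied = ℕ.*-cancelˡ-≡ (p₁ * l₁) (p₂ * k₁) n {{ℕ.>-nonZero 0<n}} (begin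
      n * (p₁ * l₁) ≡⟨ ℕ.*-assoc n p₁ l₁ ⟨
      n * p₁ * l₁   ≡⟨ cong (_* l₁) np₁ ⟩
      t * k₁ * l₁   ≡⟨ xy∙z≈xz∙y t k₁ l₁ ⟩
      t * l₁ * k₁   ≡⟨ cong (_* k₁) np₂ ⟨
      n * p₂ * k₁   ≡⟨ ℕ.*-assoc n p₂ k₁ ⟩
      n * (p₂ * k₁) ∎)
    k₁∣p₁ : k₁ ∣ p₁
    k₁∣p₁ = coprime-divisor coprime (divides p₂ (trans (ℕ.*-comm l₁ p₁) cross-multiplied))
    j : ℕ
    j = _∣_.quotient k₁∣p₁
    p₁≡ : p₁ ≡ j * k₁
    p₁≡ = _∣_.equality k₁∣p₁
    p₂≡ : p₂ ≡ j * l₁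
    p₂≡ = ℕ.*-cancelʳ-≡ p₂ (j * l₁) k₁ {{ℕ.>-nonZero 0<k₁}} (begin
      p₂ * k₁     ≡⟨ cross-multiplied ⟨
      p₁ * l₁     ≡⟨ cong (_* l₁) p₁≡ ⟩
      j * k₁ * l₁ ≡⟨ xy∙z≈xz∙y j k₁ l₁ ⟩
      j * l₁ * k₁ ∎)
    nj≡t : n * j ≡ t
    nj≡t = ℕ.*-cancelʳ-≡ (n * j) t k₁ {{ℕ.>-nonZero 0<k₁}} (begin
      n * j * k₁   ≡⟨ ℕ.*-assoc n j k₁ ⟩
      n * (j * k₁) ≡⟨ cong (n *_) p₁≡ ⟨
      n * p₁       ≡⟨ np₁ ⟩
      t * k₁       ∎)

  -ω-origin : ∀ P → P -ω 0ω ≡ P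
  -ω-origin (p₁ , p₂) = cong₂ _,_ (ℤ.+-identityʳ p₁) (ℤ.+-identityʳ p₂)

  ray : ℕ → ℕ → ℕ → ℤω
  ray k₁ l₁ j = (+ (j * k₁) , + (j * l₁))

  OnSegment-ray : ∀ {k₁ l₁ N P} → Coprime k₁ l₁ → 0 < k₁ → 0 < N →
    OnSegment 0ω (ray k₁ l₁ N) P ⇔ (Σ ℕ λ j → j ≤ N × P ≡ ray k₁ l₁ j)
  OnSegment-ray {k₁} {l₁} {N} {P} coprime 0<k₁ 0<N = mk⇔ lattice-point multiple
    where
    open ≡-Reasoning
    origin-free : ∀ {n s} → (+ n) ·ω (P -ω 0ω) ≡ (+ s) ·ω (ray k₁ l₁ N -ω 0ω) →
                  (+ n) ·ω P ≡ (+ s) ·ω ray k₁ l₁ N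
    origin-free {n} {s} = subst₂ (λ u v → (+ n) ·ω u ≡ (+ s) ·ω v) (-ω-origin P) (-ω-origin (ray k₁ l₁ N))
    coordinate : ∀ {n s i b} → 0 < n → + n ℤ.* i ≡ + s ℤ.* + b → Σ ℕ λ q → i ≡ + q × n * q ≡ s * b
    coordinate {s = s} {b = b} 0<n e = positive-multiple⇒ℕ 0<n (trans e (sym (ℤ.pos-* s b)))
    lattice-point : OnSegment 0ω (ray k₁ l₁ N) P → Σ ℕ λ j → j ≤ N × P ≡ ray k₁ l₁ j
    lattice-point (n , s , 0<n , s≤n , eq) =
      from-coordinates (coordinate {n} {s} {b = N * k₁} 0<n (cong proj₁ (origin-free {n} {s} eq)))
                       (coordinate {n} {s} {b = N * l₁} 0<n (cong proj₂ (origin-free {n} {s} eq)))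
      where
      from-coordinates : (Σ ℕ λ q → proj₁ P ≡ + q × n * q ≡ s * (N * k₁)) →
                         (Σ ℕ λ q → proj₂ P ≡ + q × n * q ≡ s * (N * l₁)) →
                         Σ ℕ λ j → j ≤ N × P ≡ ray k₁ l₁ j
      from-coordinates (q₁ , P₁≡ , nq₁) (q₂ , P₂≡ , nq₂) =
        from-ray (coprime-ray coprime 0<k₁ 0<n (trans nq₁ (sym (ℕ.*-assoc s N k₁)))
                                               (trans nq₂ (sym (ℕ.*-assoc s N l₁))))
        where
        from-ray : (Σ ℕ λ j → q₁ ≡ j * k₁ × q₂ ≡ j * l₁ × n * j ≡ s * N) →
                   Σ ℕ λ j → j ≤ N × P ≡ ray k₁ l₁ j
        from-ray (j , q₁≡ , q₂≡ , nj≡) =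
          j , ℕ.*-cancelˡ-≤ n {{ℕ.>-nonZero 0<n}} (subst (_≤ n * N) (sym nj≡) (ℕ.*-monoˡ-≤ N s≤n)) ,
          cong₂ _,_ (trans P₁≡ (cong +_ q₁≡)) (trans P₂≡ (cong +_ q₂≡))
    multiple : (Σ ℕ λ j → j ≤ N × P ≡ ray k₁ l₁ j) → OnSegment 0ω (ray k₁ l₁ N) P
    multiple (j , j≤N , refl) = N , j , 0<N , j≤N ,
      subst₂ (λ u v → (+ N) ·ω u ≡ (+ j) ·ω v) (sym (-ω-origin (ray k₁ l₁ j))) (sym (-ω-origin (ray k₁ l₁ N)))
        (cong₂ _,_ (scale k₁) (scale l₁))
      where
      scale : ∀ k → + N ℤ.* + (j * k) ≡ + j ℤ.* + (N * k)
      scale k = trans (sym (ℤ.pos-* N (j * k))) (trans (cong +_ (x∙yz≈y∙xz N j k)) (ℤ.pos-* j (N * k)))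

-- Triangles in the plane

module _ where
  open import Data.Integer using (_+_; _*_; -_; _-_; _≤_; _<_)

  cross : ℤω → ℤω → ℤ
  cross (a₁ , a₂) (b₁ , b₂) = a₁ * b₂ - a₂ * b₁

  0≤-+ : ∀ {i j} → 0ℤ ≤ i → 0ℤ ≤ j → 0ℤ ≤ i + j
  0≤-+ = ℤ.+-mono-≤

  0≤-* : ∀ {i j} → 0ℤ ≤ i → 0ℤ ≤ j → 0ℤ ≤ i * j
  0≤-* {+ m} {+ n} _ _ = subst (0ℤ ≤_) (ℤ.pos-* m n) (+≤+ z≤n)

  0<-* : ∀ {i j} → 0ℤ < i → 0ℤ < j → 0ℤ < i * j
  0<-* (+<+ (s≤s z≤n)) (+<+ (s≤s z≤n)) = +<+ (s≤s z≤n)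

  0<-+ : ∀ {i j} → 0ℤ < i → 0ℤ ≤ j → 0ℤ < i + j
  0<-+ = ℤ.+-mono-<-≤

  -- The weights are the signed areas of the triangles P B C, P C A and P A B (Cramer's rule).
  InTriangle-intro : ∀ A B C P →
    0ℤ ≤ cross (B -ω P) (C -ω P) → 0ℤ ≤ cross (C -ω P) (A -ω P) → 0ℤ ≤ cross (A -ω P) (B -ω P) →
    0ℤ < cross (B -ω A) (C -ω A) → InTriangle A B C P
  InTriangle-intro A@(a₁ , a₂) B@(b₁ , b₂) C@(c₁ , c₂) P@(p₁ , p₂) 0≤X 0≤Y 0≤W 0<area =
    x , y , w , ℤ.drop‿+<+ (subst (0ℤ <_) (sym (trans n≡X+Y+W (sum≡area a₁ a₂ b₁ b₂ c₁ c₂ p₁ p₂))) 0<area) ,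
    cong₂ _,_
      (weigh (λ X Y W → (X + Y + W) * p₁ ≡ X * a₁ + Y * b₁ + W * c₁) (coordinate₁ a₁ a₂ b₁ b₂ c₁ c₂ p₁ p₂))
      (weigh (λ X Y W → (X + Y + W) * p₂ ≡ X * a₂ + Y * b₂ + W * c₂) (coordinate₂ a₁ a₂ b₁ b₂ c₁ c₂ p₁ p₂))
    where
    X Y W : ℤ
    X = cross (B -ω P) (C -ω P)
    Y = cross (C -ω P) (A -ω P)
    W = cross (A -ω P) (B -ω P)
    x y w : ℕ
    x = ∣ X ∣
    y = ∣ Y ∣
    w = ∣ W ∣
    n≡X+Y+W : + (x ℕ.+ y ℕ.+ w) ≡ X + Y + W
    n≡X+Y+W = trans (ℤ.pos-+ (x ℕ.+ y) w)
      (cong₂ _+_ (trans (ℤ.pos-+ x y) (cong₂ _+_ (ℤ.0≤i⇒+∣i∣≡i 0≤X) (ℤ.0≤i⇒+∣i∣≡i 0≤Y)))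
                 (ℤ.0≤i⇒+∣i∣≡i 0≤W))
    weigh : (F : ℤ → ℤ → ℤ → Set) → F X Y W → F (+ x) (+ y) (+ w)
    weigh F h = subst (λ X′ → F X′ (+ y) (+ w)) (sym (ℤ.0≤i⇒+∣i∣≡i 0≤X))
      (subst (λ Y′ → F X Y′ (+ w)) (sym (ℤ.0≤i⇒+∣i∣≡i 0≤Y)) (subst (F X Y) (sym (ℤ.0≤i⇒+∣i∣≡i 0≤W)) h))
    sum≡area : ∀ a₁ a₂ b₁ b₂ c₁ c₂ p₁ p₂ →
      ((b₁ - p₁) * (c₂ - p₂) - (b₂ - p₂) * (c₁ - p₁)) + ((c₁ - p₁) * (a₂ - p₂) - (c₂ - p₂) * (a₁ - p₁))
        + ((a₁ - p₁) * (b₂ - p₂) - (a₂ - p₂) * (b₁ - p₁))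
      ≡ (b₁ - a₁) * (c₂ - a₂) - (b₂ - a₂) * (c₁ - a₁)
    sum≡area = solve-∀
    coordinate₁ : ∀ a₁ a₂ b₁ b₂ c₁ c₂ p₁ p₂ →
      let X = (b₁ - p₁) * (c₂ - p₂) - (b₂ - p₂) * (c₁ - p₁)
          Y = (c₁ - p₁) * (a₂ - p₂) - (c₂ - p₂) * (a₁ - p₁)
          W = (a₁ - p₁) * (b₂ - p₂) - (a₂ - p₂) * (b₁ - p₁)
      in (X + Y + W) * p₁ ≡ X * a₁ + Y * b₁ + W * c₁
    coordinate₁ = solve-∀
    coordinate₂ : ∀ a₁ a₂ b₁ b₂ c₁ c₂ p₁ p₂ →
      let X = (b₁ - p₁) * (c₂ - p₂) - (b₂ - p₂) * (c₁ - p₁)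
          Y = (c₁ - p₁) * (a₂ - p₂) - (c₂ - p₂) * (a₁ - p₁)
          W = (a₁ - p₁) * (b₂ - p₂) - (a₂ - p₂) * (b₁ - p₁)
      in (X + Y + W) * p₂ ≡ X * a₂ + Y * b₂ + W * c₂
    coordinate₂ = solve-∀

  InTriangle-cycle : ∀ {A B C P} → InTriangle B C A P → InTriangle A B C P
  InTriangle-cycle {a₁ , a₂} {b₁ , b₂} {c₁ , c₂} {P} (x , y , w , 0<n , eq) =
    w , x , y , subst (0 ℕ.<_) n≡ 0<n ,
    subst (λ n → (+ n) ·ω P ≡ (+ w) ·ω (a₁ , a₂) +ω (+ x) ·ω (b₁ , b₂) +ω (+ y) ·ω (c₁ , c₂)) n≡
      (trans eq (cong₂ _,_ (reorder (+ x) (+ y) (+ w) b₁ c₁ a₁) (reorder (+ x) (+ y) (+ w) b₂ c₂ a₂)))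
    where
    n≡ : x ℕ.+ y ℕ.+ w ≡ w ℕ.+ x ℕ.+ y
    n≡ = trans (ℕ.+-comm (x ℕ.+ y) w) (sym (ℕ.+-assoc w x y))
    reorder : ∀ X Y W b c a → X * b + Y * c + W * a ≡ W * a + X * b + Y * c
    reorder = solve-∀

  InTriangle⇒leftOf : ∀ A B C P → InTriangle A B C P →
    0ℤ ≤ cross (B -ω A) (C -ω A) → 0ℤ ≤ cross (B -ω A) (P -ω A)
  InTriangle⇒leftOf (a₁ , a₂) (b₁ , b₂) (c₁ , c₂) (p₁ , p₂) (x , y , w , 0<n , eq) 0≤area =
    ℤ.*-cancelˡ-≤-pos 0ℤ _ (+ n) {{ℤ.positive (+<+ 0<n)}}
      (subst₂ _≤_ (sym (ℤ.*-zeroʳ (+ n))) (sym scaled) (0≤-* {+ w} (+≤+ z≤n) 0≤area))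
    where
    n : ℕ
    n = x ℕ.+ y ℕ.+ w
    n≡ : + n ≡ + x + + y + + w
    n≡ = trans (ℤ.pos-+ (x ℕ.+ y) w) (cong (_+ + w) (ℤ.pos-+ x y))
    weights : ∀ X Y W →
      (X + Y + W) * p₁ ≡ X * a₁ + Y * b₁ + W * c₁ → (X + Y + W) * p₂ ≡ X * a₂ + Y * b₂ + W * c₂ →
      (X + Y + W) * ((b₁ - a₁) * (p₂ - a₂) - (b₂ - a₂) * (p₁ - a₁))
        ≡ W * ((b₁ - a₁) * (c₂ - a₂) - (b₂ - a₂) * (c₁ - a₁))
    weights X Y W e₁ e₂ = begin
      (X + Y + W) * ((b₁ - a₁) * (p₂ - a₂) - (b₂ - a₂) * (p₁ - a₁))
        ≡⟨ solve (X ∷ Y ∷ W ∷ a₁ ∷ a₂ ∷ b₁ ∷ b₂ ∷ p₁ ∷ p₂ ∷ []) ⟩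
      (b₁ - a₁) * ((X + Y + W) * p₂) - (b₂ - a₂) * ((X + Y + W) * p₁) - (X + Y + W) * ((b₁ - a₁) * a₂ - (b₂ - a₂) * a₁)
        ≡⟨ cong₂ (λ u v → (b₁ - a₁) * u - (b₂ - a₂) * v - (X + Y + W) * ((b₁ - a₁) * a₂ - (b₂ - a₂) * a₁)) e₂ e₁ ⟩
      (b₁ - a₁) * (X * a₂ + Y * b₂ + W * c₂) - (b₂ - a₂) * (X * a₁ + Y * b₁ + W * c₁)
        - (X + Y + W) * ((b₁ - a₁) * a₂ - (b₂ - a₂) * a₁)
        ≡⟨ solve (X ∷ Y ∷ W ∷ a₁ ∷ a₂ ∷ b₁ ∷ b₂ ∷ c₁ ∷ c₂ ∷ []) ⟩
      W * ((b₁ - a₁) * (c₂ - a₂) - (b₂ - a₂) * (c₁ - a₁)) ∎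
      where open ≡-Reasoning
    scaled : + n * cross ((b₁ , b₂) -ω (a₁ , a₂)) ((p₁ , p₂) -ω (a₁ , a₂))
           ≡ + w * cross ((b₁ , b₂) -ω (a₁ , a₂)) ((c₁ , c₂) -ω (a₁ , a₂))
    scaled = subst (λ N → N * cross ((b₁ , b₂) -ω (a₁ , a₂)) ((p₁ , p₂) -ω (a₁ , a₂))
                        ≡ + w * cross ((b₁ , b₂) -ω (a₁ , a₂)) ((c₁ , c₂) -ω (a₁ , a₂))) (sym n≡)
      (weights (+ x) (+ y) (+ w)
        (subst (λ N → N * p₁ ≡ + x * a₁ + + y * b₁ + + w * c₁) n≡ (cong proj₁ eq))
        (subst (λ N → N * p₂ ≡ + x * a₂ + + y * b₂ + + w * c₂) n≡ (cong proj₂ eq)))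

  -- The triangle 0, T•u, T•ωu with u = (K , L), ωu = (- L , K + L), T = J + R, and the points J•u + δ for
  -- δ = (1 , 1), (-2 , 1), (1 , -2).  With Q = cross u ωu = K² + K L + L², the weights of J•u + δ are
  -- T • (R Q - cross u δ - cross δ ωu), T • (J Q + cross δ ωu) and T • cross u δ.
  module RayTriangle {J R K L : ℤ}
    (1≤J : + 1 ≤ J) (1≤R : + 1 ≤ R) (2≤K : + 2 ≤ K) (1≤L : + 1 ≤ L) (L≤K : L ≤ K) where

    B C : ℤω
    B = ((J + R) * K , (J + R) * L)
    C = (- ((J + R) * L) , (J + R) * (K + L))

    private
      0≤ : ∀ {i j} → i ≤ j → 0ℤ ≤ j - i
      0≤ = ℤ.i≤j⇒0≤j-i

      0≤J : 0ℤ ≤ J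
      0≤J = ℤ.≤-trans (+≤+ z≤n) 1≤J
      0≤R : 0ℤ ≤ R
      0≤R = ℤ.≤-trans (+≤+ z≤n) 1≤R
      0≤K : 0ℤ ≤ K
      0≤K = ℤ.≤-trans (+≤+ z≤n) 2≤K
      0≤L : 0ℤ ≤ L
      0≤L = ℤ.≤-trans (+≤+ z≤n) 1≤L
      0≤T : 0ℤ ≤ J + R
      0≤T = 0≤-+ 0≤J 0≤R
      0≤Q : 0ℤ ≤ K * K + K * L + L * L
      0≤Q = 0≤-+ (0≤-+ (0≤-* 0≤K 0≤K) (0≤-* 0≤K 0≤L)) (0≤-* 0≤L 0≤L)
      0≤Q-2K-L : 0ℤ ≤ K * (K - + 2) + K * L + L * (L - + 1)
      0≤Q-2K-L = 0≤-+ (0≤-+ (0≤-* 0≤K (0≤ 2≤K)) (0≤-* 0≤K 0≤L)) (0≤-* 0≤L (0≤ 1≤L))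

      0<K : 0ℤ < K
      0<K = ℤ.<-≤-trans (+<+ (s≤s z≤n)) 2≤K
      0<T : 0ℤ < J + R
      0<T = ℤ.<-≤-trans (+<+ (s≤s z≤n)) (ℤ.+-mono-≤ 1≤J 0≤R)
      0<Q : 0ℤ < K * K + K * L + L * L
      0<Q = 0<-+ (0<-+ (0<-* 0<K 0<K) (0≤-* 0≤K 0≤L)) (0≤-* 0≤L 0≤L)

      area : ∀ J R K L → ((J + R) * K - + 0) * ((J + R) * (K + L) - + 0) - ((J + R) * L - + 0) * (- ((J + R) * L) - + 0)
                       ≡ (J + R) * (J + R) * (K * K + K * L + L * L)
      area = solve-∀

      0<area : 0ℤ < cross (B -ω 0ω) (C -ω 0ω)
      0<area = subst (0ℤ <_) (sym (area J R K L)) (0<-* (0<-* 0<T 0<T) 0<Q)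

    inside-right : InTriangle 0ω B C (J * K + + 1 , J * L + + 1)
    inside-right = InTriangle-intro 0ω B C (J * K + + 1 , J * L + + 1)
      (subst (0ℤ ≤_) (sym (x J R K L)) (0≤-* 0≤T (0≤-+ (0≤-* (0≤ 1≤R) 0≤Q) 0≤Q-2K-L)))
      (subst (0ℤ ≤_) (sym (y J R K L)) (0≤-* 0≤T (0≤-+ (0≤-+ (0≤-* 0≤J 0≤Q) 0≤K) (0≤-* {+ 2} (+≤+ z≤n) 0≤L))))
      (subst (0ℤ ≤_) (sym (w J R K L)) (0≤-* 0≤T (0≤ L≤K)))
      0<area
      where
      x : ∀ J R K L → ((J + R) * K - (J * K + + 1)) * ((J + R) * (K + L) - (J * L + + 1))
                        - ((J + R) * L - (J * L + + 1)) * (- ((J + R) * L) - (J * K + + 1))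
                    ≡ (J + R) * ((R - + 1) * (K * K + K * L + L * L) + (K * (K - + 2) + K * L + L * (L - + 1)))
      x = solve-∀
      y : ∀ J R K L → (- ((J + R) * L) - (J * K + + 1)) * (+ 0 - (J * L + + 1))
                        - ((J + R) * (K + L) - (J * L + + 1)) * (+ 0 - (J * K + + 1))
                    ≡ (J + R) * (J * (K * K + K * L + L * L) + K + + 2 * L)
      y = solve-∀
      w : ∀ J R K L → (+ 0 - (J * K + + 1)) * ((J + R) * L - (J * L + + 1))
                        - (+ 0 - (J * L + + 1)) * ((J + R) * K - (J * K + + 1))
                    ≡ (J + R) * (K - L)
      w = solve-∀

    inside-left : InTriangle 0ω B C (J * K - + 2 , J * L + + 1)
    inside-left = InTriangle-intro 0ω B C (J * K - + 2 , J * L + + 1)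
      (subst (0ℤ ≤_) (sym (x J R K L)) (0≤-* 0≤T (0≤-+ (0≤-* 0≤R 0≤Q) (0≤ L≤K))))
      (subst (0ℤ ≤_) (sym (y J R K L)) (0≤-* 0≤T (0≤-+ (0≤-* (0≤ 1≤J) 0≤Q) 0≤Q-2K-L)))
      (subst (0ℤ ≤_) (sym (w J R K L)) (0≤-* 0≤T (0≤-+ 0≤K (0≤-* {+ 2} (+≤+ z≤n) 0≤L))))
      0<area
      where
      x : ∀ J R K L → ((J + R) * K - (J * K - + 2)) * ((J + R) * (K + L) - (J * L + + 1))
                        - ((J + R) * L - (J * L + + 1)) * (- ((J + R) * L) - (J * K - + 2))
                    ≡ (J + R) * (R * (K * K + K * L + L * L) + (K - L))
      x = solve-∀
      y : ∀ J R K L → (- ((J + R) * L) - (J * K - + 2)) * (+ 0 - (J * L + + 1))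
                        - ((J + R) * (K + L) - (J * L + + 1)) * (+ 0 - (J * K - + 2))
                    ≡ (J + R) * ((J - + 1) * (K * K + K * L + L * L) + (K * (K - + 2) + K * L + L * (L - + 1)))
      y = solve-∀
      w : ∀ J R K L → (+ 0 - (J * K - + 2)) * ((J + R) * L - (J * L + + 1))
                        - (+ 0 - (J * L + + 1)) * ((J + R) * K - (J * K - + 2))
                    ≡ (J + R) * (K + + 2 * L)
      w = solve-∀

    outside-below : ¬ InTriangle 0ω B C (J * K + + 1 , J * L - + 2)
    outside-below inside = ℤ.<⇒≱ negative (InTriangle⇒leftOf 0ω B C _ inside (ℤ.<⇒≤ 0<area))
      where
      below : ∀ J R K L → ((J + R) * K - + 0) * ((J * L - + 2) - + 0) - ((J + R) * L - + 0) * ((J * K + + 1) - + 0)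
                        ≡ - ((J + R) * (+ 2 * K + L))
      below = solve-∀
      negative : cross (B -ω 0ω) ((J * K + + 1 , J * L - + 2) -ω 0ω) < 0ℤ
      negative = subst (_< 0ℤ) (sym (below J R K L))
        (ℤ.neg-mono-< (0<-* 0<T (0<-+ (0<-* {+ 2} (+<+ (s≤s z≤n)) 0<K) 0≤L)))

-- Barycentres of small triangles

module _ where
  open import Data.Integer using (_+_; _*_; -_; _-_; _≤_; _<_)
  open import Data.Nat using (_%_; _/_)

  three∣difference⇒≡ : ∀ {r s} z → r ℕ.< 3 → s ℕ.< 3 → + 3 * z ≡ + r - + s → r ≡ s
  three∣difference⇒≡ {r} {s} z r<3 s<3 eq = small r s r<3 s<3 divisible
    where
    divisible : ∣ + r - + s ∣ % 3 ≡ 0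
    divisible = begin
      ∣ + r - + s ∣ % 3  ≡⟨ cong (λ t → ∣ t ∣ % 3) (sym eq) ⟩
      ∣ + 3 * z ∣ % 3    ≡⟨ cong (_% 3) (trans (ℤ.abs-* (+ 3) z) (ℕ.*-comm 3 ∣ z ∣)) ⟩
      (∣ z ∣ ℕ.* 3) % 3  ≡⟨ m*n%n≡0 ∣ z ∣ 3 ⟩
      0                  ∎
      where open ≡-Reasoning
    small : ∀ r s → r ℕ.< 3 → s ℕ.< 3 → ∣ + r - + s ∣ % 3 ≡ 0 → r ≡ s
    small 0 0 _ _ _ = refl
    small 1 1 _ _ _ = refl
    small 2 2 _ _ _ = refl
    small 0 1 _ _ ()
    small 0 2 _ _ ()
    small 1 0 _ _ ()
    small 1 2 _ _ ()
    small 2 0 _ _ ()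
    small 2 1 _ _ ()
    small (suc (suc (suc _))) _ (s≤s (s≤s (s≤s ()))) _ _
    small _ (suc (suc (suc _))) _ (s≤s (s≤s (s≤s ()))) _

  remainder-unique : ∀ {a b r s} → r ℕ.< 3 → s ℕ.< 3 → + 3 * a + + r ≡ + 3 * b + + s → a ≡ b × r ≡ s
  remainder-unique {a} {b} {r} {s} r<3 s<3 eq = a≡b , r≡s
    where
    difference : ∀ R S → + 3 * a + R ≡ + 3 * b + S → + 3 * (b - a) ≡ R - S
    difference R S e = begin
      + 3 * (b - a)                           ≡⟨ solve (a ∷ b ∷ R ∷ S ∷ []) ⟩
      (+ 3 * b + S) - (+ 3 * a + R) + (R - S) ≡⟨ cong (λ t → (+ 3 * b + S) - t + (R - S)) e ⟩
      (+ 3 * b + S) - (+ 3 * b + S) + (R - S) ≡⟨ solve (b ∷ R ∷ S ∷ []) ⟩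
      R - S                                   ∎
      where open ≡-Reasoning
    3[b-a]≡r-s : + 3 * (b - a) ≡ + r - + s
    3[b-a]≡r-s = difference (+ r) (+ s) eq
    r≡s : r ≡ s
    r≡s = three∣difference⇒≡ (b - a) r<3 s<3 3[b-a]≡r-s
    a≡b : a ≡ b
    a≡b = sym (ℤ.i-j≡0⇒i≡j b a (ℤ.*-cancelˡ-≡ (+ 3) (b - a) 0ℤ
      (trans 3[b-a]≡r-s (trans (cong (λ t → + r - + t) (sym r≡s)) (ℤ.+-inverseʳ (+ r))))))

  +-divmod3 : ∀ X → + X ≡ + 3 * + (X / 3) + + (X % 3)
  +-divmod3 X = begin
    + X                              ≡⟨ cong +_ (m≡m%n+[m/n]*n X 3) ⟩
    + (X % 3 ℕ.+ X / 3 ℕ.* 3)        ≡⟨ trans (ℤ.pos-+ (X % 3) _) (cong (λ t → + (X % 3) + t) (ℤ.pos-* (X / 3) 3)) ⟩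
    + (X % 3) + + (X / 3) * + 3      ≡⟨ reorder (+ (X / 3)) (+ (X % 3)) ⟩
    + 3 * + (X / 3) + + (X % 3)      ∎
    where
    reorder : ∀ q r → r + q * + 3 ≡ + 3 * q + r
    reorder = solve-∀
    open ≡-Reasoning

  divmod3-unique : ∀ {a r X} → r ℕ.< 3 → + 3 * a + + r ≡ + X → a ≡ + (X / 3) × r ≡ X % 3
  divmod3-unique {X = X} r<3 eq = remainder-unique r<3 (m%n<n X 3) (trans eq (+-divmod3 X))

  bary3-up : ∀ a b → bary3 (up a b) ≡ (+ 3 * a + + 1 , + 3 * b + + 1)
  bary3-up a b = cong₂ _,_ (sum₁ a) (sum₂ b)
    where
    sum₁ : ∀ a → a + (a + + 1) + a ≡ + 3 * a + + 1
    sum₁ = solve-∀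
    sum₂ : ∀ b → b + b + (b + + 1) ≡ + 3 * b + + 1
    sum₂ = solve-∀

  bary3-down : ∀ a b → bary3 (down a b) ≡ (+ 3 * (a - + 1) + + 2 , + 3 * b + + 2)
  bary3-down a b = cong₂ _,_ (sum₁ a) (sum₂ b)
    where
    sum₁ : ∀ a → a + a + (a - + 1) ≡ + 3 * (a - + 1) + + 2
    sum₁ = solve-∀
    sum₂ : ∀ b → b + (b + + 1) + (b + + 1) ≡ + 3 * b + + 2
    sum₂ = solve-∀

  IsDown : SmallTri → Set
  IsDown (up _ _)   = ⊥
  IsDown (down _ _) = ⊤

  Residues : ℕ → ℕ → ℕ → Set
  Residues r X Y = X % 3 ≡ r × Y % 3 ≡ r

  upAt downAt : ℕ → ℕ → SmallTri
  upAt X Y = up (+ (X / 3)) (+ (Y / 3))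
  downAt X Y = down (+ (X / 3) + + 1) (+ (Y / 3))

  private
    coordinate-of-residue : ∀ {Z r} → Z % 3 ≡ r → + 3 * + (Z / 3) + + r ≡ + Z
    coordinate-of-residue {Z} refl = sym (+-divmod3 Z)

    1<3 : 1 ℕ.< 3
    1<3 = s≤s (s≤s z≤n)

    2<3 : 2 ℕ.< 3
    2<3 = s≤s (s≤s (s≤s z≤n))

  bary3-upAt : ∀ {X Y} → Residues 1 X Y → bary3 (upAt X Y) ≡ (+ X , + Y)
  bary3-upAt {X} {Y} (X≡ , Y≡) = trans (bary3-up (+ (X / 3)) (+ (Y / 3)))
    (cong₂ _,_ (coordinate-of-residue X≡) (coordinate-of-residue Y≡))

  bary3-downAt : ∀ {X Y} → Residues 2 X Y → bary3 (downAt X Y) ≡ (+ X , + Y)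
  bary3-downAt {X} {Y} (X≡ , Y≡) = trans (bary3-down (+ (X / 3) + + 1) (+ (Y / 3)))
    (cong₂ _,_ (trans (shift (+ (X / 3))) (coordinate-of-residue X≡)) (coordinate-of-residue Y≡))
    where
    shift : ∀ q → + 3 * ((q + + 1) - + 1) + + 2 ≡ + 3 * q + + 2
    shift = solve-∀

  nonzero-residues : ∀ {r X Y} → Residues r X Y → r ≢ 0 → X % 3 ≢ 0 × X % 3 ≡ Y % 3
  nonzero-residues (X≡ , Y≡) r≢0 = (λ X≡0 → r≢0 (trans (sym X≡) X≡0)) , trans X≡ (sym Y≡)

  up-by-bary3 : ∀ {T X Y} → IsUp T → bary3 T ≡ (+ X , + Y) → T ≡ upAt X Y × Residues 1 X Y
  up-by-bary3 {up a b} {X} {Y} _ eq = cong₂ up (proj₁ first) (proj₁ second) , sym (proj₂ first) , sym (proj₂ second)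
    where
    first : a ≡ + (X / 3) × 1 ≡ X % 3
    first = divmod3-unique 1<3 (trans (sym (cong proj₁ (bary3-up a b))) (cong proj₁ eq))
    second : b ≡ + (Y / 3) × 1 ≡ Y % 3
    second = divmod3-unique 1<3 (trans (sym (cong proj₂ (bary3-up a b))) (cong proj₂ eq))

  down-by-bary3 : ∀ {T X Y} → IsDown T → bary3 T ≡ (+ X , + Y) → T ≡ downAt X Y × Residues 2 X Y
  down-by-bary3 {down a b} {X} {Y} _ eq =
    cong₂ down (trans (unshift a) (cong (_+ + 1) (proj₁ first))) (proj₁ second) , sym (proj₂ first) , sym (proj₂ second)
    where
    first : a - + 1 ≡ + (X / 3) × 2 ≡ X % 3
    first = divmod3-unique 2<3 (trans (sym (cong proj₁ (bary3-down a b))) (cong proj₁ eq))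
    second : b ≡ + (Y / 3) × 2 ≡ Y % 3
    second = divmod3-unique 2<3 (trans (sym (cong proj₂ (bary3-down a b))) (cong proj₂ eq))
    unshift : ∀ a → a ≡ (a - + 1) + + 1
    unshift = solve-∀

  bary3-residues : ∀ {T X Y} → bary3 T ≡ (+ X , + Y) → X % 3 ≢ 0 × X % 3 ≡ Y % 3
  bary3-residues {up a b} {X} {Y} eq = nonzero-residues {1} {X} {Y} (proj₂ (up-by-bary3 {up a b} {X} {Y} tt eq)) λ ()
  bary3-residues {down a b} {X} {Y} eq = nonzero-residues {2} {X} {Y} (proj₂ (down-by-bary3 {down a b} {X} {Y} tt eq)) λ ()

  bary3-right-of-up : ∀ a b → bary3 (down (a + + 1) b) ≡ bary3 (up a b) +ω (+ 1 , + 1)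
  bary3-right-of-up a b = cong₂ _,_ (first a) (second b)
    where
    first : ∀ a → a + + 1 + (a + + 1) + (a + + 1 - + 1) ≡ a + (a + + 1) + a + + 1
    first = solve-∀
    second : ∀ b → b + (b + + 1) + (b + + 1) ≡ b + b + (b + + 1) + + 1
    second = solve-∀

  bary3-left-of-up : ∀ a b → bary3 (down a b) ≡ bary3 (up a b) +ω (- + 2 , + 1)
  bary3-left-of-up a b = cong₂ _,_ (first a) (second b)
    where
    first : ∀ a → a + a + (a - + 1) ≡ a + (a + + 1) + a + - + 2
    first = solve-∀
    second : ∀ b → b + (b + + 1) + (b + + 1) ≡ b + b + (b + + 1) + + 1
    second = solve-∀

  bary3-below-up : ∀ a b → bary3 (down (a + + 1) (b - + 1)) ≡ bary3 (up a b) +ω (+ 1 , - + 2)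
  bary3-below-up a b = cong₂ _,_ (first a) (second b)
    where
    first : ∀ a → a + + 1 + (a + + 1) + (a + + 1 - + 1) ≡ a + (a + + 1) + a + + 1
    first = solve-∀
    second : ∀ b → b - + 1 + (b - + 1 + + 1) + (b - + 1 + + 1) ≡ b + b + (b + + 1) + - + 2
    second = solve-∀

-- Edge-neighbours of an upward triangle

module _ where
  open import Data.Integer using (_+_; _*_; -_; _-_; _≤_; _<_)

  _≟ω_ : DecidableEquality ℤω
  _≟ω_ = ≡-dec ℤ._≟_ ℤ._≟_

  +ω-transpose : ∀ {x u y v} → x +ω u ≡ y +ω v → y ≡ x +ω (u -ω v)
  +ω-transpose {x₁ , x₂} {u₁ , u₂} {y₁ , y₂} {v₁ , v₂} eq =
    cong₂ _,_ (trans (shift y₁ v₁) (trans (cong (_- v₁) (sym (cong proj₁ eq))) (regroup x₁ u₁ v₁)))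
              (trans (shift y₂ v₂) (trans (cong (_- v₂) (sym (cong proj₂ eq))) (regroup x₂ u₂ v₂)))
    where
    shift : ∀ y v → y ≡ y + v - v
    shift = solve-∀
    regroup : ∀ x u v → x + u - v ≡ x + (u - v)
    regroup = solve-∀

  +ω-cancelˡ : ∀ {x u v} → x +ω u ≡ x +ω v → u ≡ v
  +ω-cancelˡ {x₁ , x₂} {u₁ , u₂} {v₁ , v₂} eq =
    cong₂ _,_ (trans (unshift x₁ u₁) (trans (cong (_- x₁) (cong proj₁ eq)) (sym (unshift x₁ v₁))))
              (trans (unshift x₂ u₂) (trans (cong (_- x₂) (cong proj₂ eq)) (sym (unshift x₂ v₂))))
    where
    unshift : ∀ x u → u ≡ x + u - x
    unshift = solve-∀

  ▲ ▽ : SmallTri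
  ▲ = up (+ 0) (+ 0)
  ▽ = down (+ 0) (+ 0)

  anchor : SmallTri → ℤω
  anchor (up a b)   = (a , b)
  anchor (down a b) = (a , b)

  shape : SmallTri → SmallTri
  shape (up _ _)   = ▲
  shape (down _ _) = ▽

  vertex-anchor : ∀ T j → vertex T j ≡ anchor T +ω vertex (shape T) j
  vertex-anchor (up a b)   zero             = sym (cong₂ _,_ (ℤ.+-identityʳ a) (ℤ.+-identityʳ b))
  vertex-anchor (up a b)   (suc zero)       = sym (cong (a + + 1 ,_) (ℤ.+-identityʳ b))
  vertex-anchor (up a b)   (suc (suc zero)) = sym (cong (_, b + + 1) (ℤ.+-identityʳ a))
  vertex-anchor (down a b) zero             = sym (cong₂ _,_ (ℤ.+-identityʳ a) (ℤ.+-identityʳ b))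
  vertex-anchor (down a b) (suc zero)       = sym (cong (_, b + + 1) (ℤ.+-identityʳ a))
  vertex-anchor (down a b) (suc (suc zero)) = refl

  offset : SmallTri → Fin 3 → Fin 3 → ℤω
  offset S₀ i i′ = vertex ▲ i -ω vertex S₀ i′

  SharedEdge : SmallTri → Fin 3 → Fin 3 → Fin 3 → Fin 3 → Set
  SharedEdge S₀ i j i′ j′ = i ≢ j × offset S₀ i i′ ≡ offset S₀ j j′

  sharedEdge? : ∀ S₀ i j i′ j′ → Dec (SharedEdge S₀ i j i′ j′)
  sharedEdge? S₀ i j i′ j′ = ¬? (i Fin.≟ j) ×-dec (offset S₀ i i′ ≟ω offset S₀ j j′)

  -- Decided by evaluation over all 81 choices of the shared vertices.
  ▲-offsets : ∀ i j i′ j′ → SharedEdge ▲ i j i′ j′ → offset ▲ i i′ ≡ 0ω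
  ▲-offsets = toWitness {a? = Fin.all? λ i → Fin.all? λ j → Fin.all? λ i′ → Fin.all? λ j′ →
    sharedEdge? ▲ i j i′ j′ →-dec offset ▲ i i′ ≟ω 0ω} _

  ▽-offsets : ∀ i j i′ j′ → SharedEdge ▽ i j i′ j′ →
    offset ▽ i i′ ≡ (+ 1 , + 0) ⊎ offset ▽ i i′ ≡ (+ 0 , + 0) ⊎ offset ▽ i i′ ≡ (+ 1 , -[1+ 0 ])
  ▽-offsets = toWitness {a? = Fin.all? λ i → Fin.all? λ j → Fin.all? λ i′ → Fin.all? λ j′ →
    sharedEdge? ▽ i j i′ j′ →-dec
      (offset ▽ i i′ ≟ω (+ 1 , + 0) ⊎-dec offset ▽ i i′ ≟ω (+ 0 , + 0) ⊎-dec offset ▽ i i′ ≟ω (+ 1 , -[1+ 0 ]))} _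

  Neighbour : ℤ → ℤ → SmallTri → Set
  Neighbour a b S = S ≡ down (a + + 1) b ⊎ S ≡ down a b ⊎ S ≡ down (a + + 1) (b - + 1)

  ▲-neighbours : ∀ {a b S} → EdgeAdjacent (up a b) S → Neighbour a b S
  ▲-neighbours {a} {b} {S} (T≢S , _ , _ , p≢q , (i , refl) , (j , refl) , (i′ , pS) , (j′ , qS)) =
    classify S T≢S i j i′ j′ (anchor≡ i i′ pS)
      (i≢j , +ω-cancelˡ {a , b} {offset (shape S) i i′} {offset (shape S) j j′}
                        (trans (sym (anchor≡ i i′ pS)) (anchor≡ j j′ qS)))
    where
    i≢j : i ≢ j
    i≢j refl = p≢q refl
    anchor≡ : ∀ i i′ → vertex S i′ ≡ vertex (up a b) i → anchor S ≡ (a , b) +ω offset (shape S) i i′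
    anchor≡ i i′ eq = +ω-transpose {a , b} {vertex ▲ i} {anchor S} {vertex (shape S) i′}
      (trans (sym (vertex-anchor (up a b) i)) (trans (sym eq) (vertex-anchor S i′)))
    at : ∀ {c d} o {x y} → (c , d) ≡ (a , b) +ω o → o ≡ (x , y) → (c , d) ≡ (a + x , b + y)
    at _ anchor≡ refl = anchor≡
    down≡ : ∀ {c d x y x′ y′} → (c , d) ≡ (x , y) → x ≡ x′ → y ≡ y′ → down c d ≡ down x′ y′
    down≡ e p q = cong₂ down (trans (cong proj₁ e) p) (trans (cong proj₂ e) q)
    classify : ∀ S → up a b ≢ S → ∀ i j i′ j′ →
      anchor S ≡ (a , b) +ω offset (shape S) i i′ → SharedEdge (shape S) i j i′ j′ → Neighbour a b S
    classify (up c d) T≢S i j i′ j′ anchor≡ shared =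
      ⊥-elim (T≢S (sym (cong₂ up (trans (cong proj₁ e) (ℤ.+-identityʳ a)) (trans (cong proj₂ e) (ℤ.+-identityʳ b)))))
      where
      e : (c , d) ≡ (a + + 0 , b + + 0)
      e = at (offset ▲ i i′) anchor≡ (▲-offsets i j i′ j′ shared)
    classify (down c d) _ i j i′ j′ anchor≡ shared = place (▽-offsets i j i′ j′ shared)
      where
      place : offset ▽ i i′ ≡ (+ 1 , + 0) ⊎ offset ▽ i i′ ≡ (+ 0 , + 0) ⊎ offset ▽ i i′ ≡ (+ 1 , -[1+ 0 ]) →
              Neighbour a b (down c d)
      place (inj₁ o≡) = inj₁ (down≡ (at (offset ▽ i i′) anchor≡ o≡) refl (ℤ.+-identityʳ b))
      place (inj₂ (inj₁ o≡)) =
        inj₂ (inj₁ (down≡ (at (offset ▽ i i′) anchor≡ o≡) (ℤ.+-identityʳ a) (ℤ.+-identityʳ b)))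
      place (inj₂ (inj₂ o≡)) = inj₂ (inj₂ (down≡ (at (offset ▽ i i′) anchor≡ o≡) refl refl))

  i+1≢i : ∀ a → a + + 1 ≢ a
  i+1≢i a eq = 1≢0 (trans (unshift a) (trans (cong (_- a) eq) (ℤ.+-inverseʳ a)))
    where
    unshift : ∀ a → + 1 ≡ a + + 1 - a
    unshift = solve-∀
    1≢0 : + 1 ≢ 0ℤ
    1≢0 ()

-- The rotation of △

module _ where
  open import Data.Integer using (_+_; _*_; -_; _-_; _≤_; _<_)

  order3⇒injective : ∀ {A : Set} {f : A → A} → (∀ x → f (f (f x)) ≡ x) → ∀ {x y} → f x ≡ f y → x ≡ y
  order3⇒injective {f = f} f³ {x} {y} eq = trans (sym (f³ x)) (trans (cong (λ z → f (f z)) eq) (f³ y))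

  next³ : ∀ i → next (next (next i)) ≡ i
  next³ zero = refl
  next³ (suc zero) = refl
  next³ (suc (suc zero)) = refl

  module Rotation (k l : ℕ) where

    private
      K L : ℤ
      K = + k
      L = + l

    -- The rotation by 2π/3 about the centre of △ is p ↦ z + ω² p, with ω² (x , y) = (- x - y , x);
    -- rotV is its action on lattice points, rotP on encoded points and rotT on small triangles.
    rotV rotP : ℤω → ℤω
    rotV (x , y) = (K - x - y , L + x)
    rotP (x , y) = (+ 3 * K - x - y , + 3 * L + x)

    rotT : SmallTri → SmallTri
    rotT (up a b)   = up (K - a - b - + 1) (L + a)
    rotT (down a b) = down (K - a - b) (L + a - + 1)

    rotV³ : ∀ p → rotV (rotV (rotV p)) ≡ p
    rotV³ (x , y) = cong₂ _,_ (first K L x y) (second K L x y)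
      where
      first : ∀ K L x y → K - (K - (K - x - y) - (L + x)) - (L + (K - x - y)) ≡ x
      first = solve-∀
      second : ∀ K L x y → L + (K - (K - x - y) - (L + x)) ≡ y
      second = solve-∀

    rotP³ : ∀ P → rotP (rotP (rotP P)) ≡ P
    rotP³ (x , y) = cong₂ _,_ (first K L x y) (second K L x y)
      where
      first : ∀ K L x y →
        + 3 * K - (+ 3 * K - (+ 3 * K - x - y) - (+ 3 * L + x)) - (+ 3 * L + (+ 3 * K - x - y)) ≡ x
      first = solve-∀
      second : ∀ K L x y → + 3 * L + (+ 3 * K - (+ 3 * K - x - y) - (+ 3 * L + x)) ≡ y
      second = solve-∀

    rotT³ : ∀ T → rotT (rotT (rotT T)) ≡ T
    rotT³ (up a b) = cong₂ up (first K L a b) (second K L a b)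
      where
      first : ∀ K L a b → K - (K - (K - a - b - + 1) - (L + a) - + 1) - (L + (K - a - b - + 1)) - + 1 ≡ a
      first = solve-∀
      second : ∀ K L a b → L + (K - (K - a - b - + 1) - (L + a) - + 1) ≡ b
      second = solve-∀
    rotT³ (down a b) = cong₂ down (first K L a b) (second K L a b)
      where
      first : ∀ K L a b → K - (K - (K - a - b) - (L + a - + 1)) - (L + (K - a - b) - + 1) ≡ a
      first = solve-∀
      second : ∀ K L a b → L + (K - (K - a - b) - (L + a - + 1)) - + 1 ≡ b
      second = solve-∀

    rot3≡rotP : ∀ P → rot3 k l P ≡ rotP P
    rot3≡rotP (x , y) = cong₂ _,_ (first K L x y) (second K L x y)
      where
      first : ∀ K L x y →
        K + (+ 0 * K - + 1 * L) +
          ((+ 0 * + 0 - + 1 * + 1) * (x - (K + (+ 0 * K - + 1 * L)))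
            - (+ 0 * + 1 + + 1 * + 0 + + 1 * + 1) * (y - (L + (+ 0 * L + + 1 * K + + 1 * L))))
        ≡ + 3 * K - x - y
      first = solve-∀
      second : ∀ K L x y →
        L + (+ 0 * L + + 1 * K + + 1 * L) +
          ((+ 0 * + 0 - + 1 * + 1) * (y - (L + (+ 0 * L + + 1 * K + + 1 * L)))
            + (+ 0 * + 1 + + 1 * + 0 + + 1 * + 1) * (x - (K + (+ 0 * K - + 1 * L)))
            + (+ 0 * + 1 + + 1 * + 0 + + 1 * + 1) * (y - (L + (+ 0 * L + + 1 * K + + 1 * L))))
        ≡ + 3 * L + x
      second = solve-∀

    bary3-rotT : ∀ T → bary3 (rotT T) ≡ rotP (bary3 T)
    bary3-rotT (up a b) = cong₂ _,_ (first K a b) (second L a)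
      where
      first : ∀ K a b → (K - a - b - + 1) + ((K - a - b - + 1) + + 1) + (K - a - b - + 1)
                      ≡ + 3 * K - (a + (a + + 1) + a) - (b + b + (b + + 1))
      first = solve-∀
      second : ∀ L a → (L + a) + (L + a) + ((L + a) + + 1) ≡ + 3 * L + (a + (a + + 1) + a)
      second = solve-∀
    bary3-rotT (down a b) = cong₂ _,_ (first K a b) (second L a)
      where
      first : ∀ K a b → (K - a - b) + (K - a - b) + ((K - a - b) - + 1)
                      ≡ + 3 * K - (a + a + (a - + 1)) - (b + (b + + 1) + (b + + 1))
      first = solve-∀
      second : ∀ L a → (L + a - + 1) + ((L + a - + 1) + + 1) + ((L + a - + 1) + + 1)
                     ≡ + 3 * L + (a + a + (a - + 1))
      second = solve-∀

    vertex-rotT : ∀ T j → vertex (rotT T) (next j) ≡ rotV (vertex T j)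
    vertex-rotT (up a b) zero = cong₂ _,_ (first K a b) refl
      where
      first : ∀ K a b → K - a - b - + 1 + + 1 ≡ K - a - b
      first = solve-∀
    vertex-rotT (up a b) (suc zero) = cong₂ _,_ (first K a b) (second L a)
      where
      first : ∀ K a b → K - a - b - + 1 ≡ K - (a + + 1) - b
      first = solve-∀
      second : ∀ L a → L + a + + 1 ≡ L + (a + + 1)
      second = solve-∀
    vertex-rotT (up a b) (suc (suc zero)) = cong₂ _,_ (first K a b) refl
      where
      first : ∀ K a b → K - a - b - + 1 ≡ K - a - (b + + 1)
      first = solve-∀
    vertex-rotT (down a b) zero = cong₂ _,_ refl (second L a)
      where
      second : ∀ L a → L + a - + 1 + + 1 ≡ L + a
      second = solve-∀
    vertex-rotT (down a b) (suc zero) = cong₂ _,_ (first K a b) (second L a)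
      where
      first : ∀ K a b → K - a - b - + 1 ≡ K - a - (b + + 1)
      first = solve-∀
      second : ∀ L a → L + a - + 1 + + 1 ≡ L + a
      second = solve-∀
    vertex-rotT (down a b) (suc (suc zero)) = cong₂ _,_ (first K a b) (second L a)
      where
      first : ∀ K a b → K - a - b ≡ K - (a - + 1) - (b + + 1)
      first = solve-∀
      second : ∀ L a → L + a - + 1 ≡ L + (a - + 1)
      second = solve-∀

    rotP-corner3 : ∀ i → rotP (corner3 k l i) ≡ corner3 k l (next i)
    rotP-corner3 zero = cong₂ _,_ (first K) (second L)
      where
      first : ∀ K → + 3 * K - + 3 * + 0 - + 3 * + 0 ≡ + 3 * K
      first = solve-∀
      second : ∀ L → + 3 * L + + 3 * + 0 ≡ + 3 * L
      second = solve-∀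
    rotP-corner3 (suc zero) = cong₂ _,_ (first K L) (second K L)
      where
      first : ∀ K L → + 3 * K - + 3 * K - + 3 * L ≡ + 3 * (+ 0 * K - + 1 * L)
      first = solve-∀
      second : ∀ K L → + 3 * L + + 3 * K ≡ + 3 * (+ 0 * L + + 1 * K + + 1 * L)
      second = solve-∀
    rotP-corner3 (suc (suc zero)) = cong₂ _,_ (first K L) (second K L)
      where
      first : ∀ K L → + 3 * K - + 3 * (+ 0 * K - + 1 * L) - + 3 * (+ 0 * L + + 1 * K + + 1 * L)
                    ≡ + 3 * + 0
      first = solve-∀
      second : ∀ K L → + 3 * L + + 3 * (+ 0 * K - + 1 * L) ≡ + 3 * + 0
      second = solve-∀

    rotP-OnSegment : ∀ {A B P} → OnSegment A B P → OnSegment (rotP A) (rotP B) (rotP P)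
    rotP-OnSegment {a₁ , a₂} {b₁ , b₂} {p₁ , p₂} (n , s , 0<n , s≤n , eq) =
      n , s , 0<n , s≤n , cong₂ _,_
        (trans (first (+ n) K p₁ p₂ a₁ a₂)
          (trans (cong₂ (λ u v → - u - v) e₁ e₂) (sym (first (+ s) K b₁ b₂ a₁ a₂))))
        (trans (second (+ n) L p₁ a₁) (trans e₁ (sym (second (+ s) L b₁ a₁))))
      where
      e₁ : + n * (p₁ - a₁) ≡ + s * (b₁ - a₁)
      e₁ = cong proj₁ eq
      e₂ : + n * (p₂ - a₂) ≡ + s * (b₂ - a₂)
      e₂ = cong proj₂ eq
      first : ∀ N K x₁ x₂ y₁ y₂ →
        N * ((+ 3 * K - x₁ - x₂) - (+ 3 * K - y₁ - y₂)) ≡ - (N * (x₁ - y₁)) - N * (x₂ - y₂)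
      first = solve-∀
      second : ∀ N L x₁ y₁ → N * ((+ 3 * L + x₁) - (+ 3 * L + y₁)) ≡ N * (x₁ - y₁)
      second = solve-∀

    rotP-InTriangle : ∀ {A B C P} → InTriangle A B C P → InTriangle (rotP A) (rotP B) (rotP C) (rotP P)
    rotP-InTriangle {a₁ , a₂} {b₁ , b₂} {c₁ , c₂} {p₁ , p₂} (x , y , w , 0<n , eq) =
      x , y , w , 0<n ,
      subst (λ N → N ·ω rotP (p₁ , p₂) ≡ + x ·ω rotP (a₁ , a₂) +ω + y ·ω rotP (b₁ , b₂) +ω + w ·ω rotP (c₁ , c₂))
        (sym n≡) (cong₂ _,_ (first K (+ x) (+ y) (+ w) e₁ e₂) (second L (+ x) (+ y) (+ w) e₁))
      where
      n≡ : + (x ℕ.+ y ℕ.+ w) ≡ + x + + y + + w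
      n≡ = trans (ℤ.pos-+ (x ℕ.+ y) w) (cong (_+ + w) (ℤ.pos-+ x y))
      e₁ : (+ x + + y + + w) * p₁ ≡ + x * a₁ + + y * b₁ + + w * c₁
      e₁ = subst (λ N → N * p₁ ≡ + x * a₁ + + y * b₁ + + w * c₁) n≡ (cong proj₁ eq)
      e₂ : (+ x + + y + + w) * p₂ ≡ + x * a₂ + + y * b₂ + + w * c₂
      e₂ = subst (λ N → N * p₂ ≡ + x * a₂ + + y * b₂ + + w * c₂) n≡ (cong proj₂ eq)
      first : ∀ K X Y W →
        (X + Y + W) * p₁ ≡ X * a₁ + Y * b₁ + W * c₁ → (X + Y + W) * p₂ ≡ X * a₂ + Y * b₂ + W * c₂ →
        (X + Y + W) * (+ 3 * K - p₁ - p₂)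
          ≡ X * (+ 3 * K - a₁ - a₂) + Y * (+ 3 * K - b₁ - b₂) + W * (+ 3 * K - c₁ - c₂)
      first K X Y W f₁ f₂ = begin
        (X + Y + W) * (+ 3 * K - p₁ - p₂)
          ≡⟨ solve (X ∷ Y ∷ W ∷ K ∷ p₁ ∷ p₂ ∷ []) ⟩
        (X + Y + W) * (+ 3 * K) - (X + Y + W) * p₁ - (X + Y + W) * p₂
          ≡⟨ cong₂ (λ u v → (X + Y + W) * (+ 3 * K) - u - v) f₁ f₂ ⟩
        (X + Y + W) * (+ 3 * K) - (X * a₁ + Y * b₁ + W * c₁) - (X * a₂ + Y * b₂ + W * c₂)
          ≡⟨ solve (X ∷ Y ∷ W ∷ K ∷ a₁ ∷ a₂ ∷ b₁ ∷ b₂ ∷ c₁ ∷ c₂ ∷ []) ⟩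
        X * (+ 3 * K - a₁ - a₂) + Y * (+ 3 * K - b₁ - b₂) + W * (+ 3 * K - c₁ - c₂) ∎
        where open ≡-Reasoning
      second : ∀ L X Y W → (X + Y + W) * p₁ ≡ X * a₁ + Y * b₁ + W * c₁ →
        (X + Y + W) * (+ 3 * L + p₁) ≡ X * (+ 3 * L + a₁) + Y * (+ 3 * L + b₁) + W * (+ 3 * L + c₁)
      second L X Y W f₁ = begin
        (X + Y + W) * (+ 3 * L + p₁)
          ≡⟨ solve (X ∷ Y ∷ W ∷ L ∷ p₁ ∷ []) ⟩
        (X + Y + W) * (+ 3 * L) + (X + Y + W) * p₁
          ≡⟨ cong (λ u → (X + Y + W) * (+ 3 * L) + u) f₁ ⟩
        (X + Y + W) * (+ 3 * L) + (X * a₁ + Y * b₁ + W * c₁)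
          ≡⟨ solve (X ∷ Y ∷ W ∷ L ∷ a₁ ∷ b₁ ∷ c₁ ∷ []) ⟩
        X * (+ 3 * L + a₁) + Y * (+ 3 * L + b₁) + W * (+ 3 * L + c₁) ∎
        where open ≡-Reasoning

    OnSide-rotP : ∀ i {P} → OnSide k l i P → OnSide k l (next i) (rotP P)
    OnSide-rotP i {P} h =
      subst₂ (λ A B → OnSegment A B (rotP P)) (rotP-corner3 i) (rotP-corner3 (next i)) (rotP-OnSegment h)

    InTri-rotP : ∀ {P} → InTri k l P → InTri k l (rotP P)
    InTri-rotP {P} h = InTriangle-cycle
      (subst₂ (λ A B → InTriangle A B (corner3 k l zero) (rotP P)) (rotP-corner3 zero) (rotP-corner3 (suc zero))
        (subst (λ C → InTriangle (rotP (corner3 k l zero)) (rotP (corner3 k l (suc zero))) C (rotP P))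
          (rotP-corner3 (suc (suc zero))) (rotP-InTriangle h)))

    IsVertex-rot : ∀ {p T} → IsVertex p T → IsVertex (rotV p) (rotT T)
    IsVertex-rot {T = T} (j , refl) = next j , vertex-rotT T j

    EdgeAdjacent-rot : ∀ {T S} → EdgeAdjacent T S → EdgeAdjacent (rotT T) (rotT S)
    EdgeAdjacent-rot (T≢S , p , q , p≢q , pT , qT , pS , qS) =
      (λ eq → T≢S (order3⇒injective rotT³ eq)) , rotV p , rotV q , (λ eq → p≢q (order3⇒injective rotV³ eq)) ,
      IsVertex-rot pT , IsVertex-rot qT , IsVertex-rot pS , IsVertex-rot qS

    IsUp-rot : ∀ T → IsUp T → IsUp (rotT T)
    IsUp-rot (up a b) _ = tt

    reflect : (P : Fin 3 → SmallTri → Set) → (∀ i T → P i T → P (next i) (rotT T)) →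
      ∀ i T → P (next i) (rotT T) → P i T
    reflect P step i T h = subst₂ P (next³ i) (rotT³ T) (step _ _ (step _ _ h))

    HasExactly-rotT : ∀ {n} {P Q : SmallTri → Set} → (∀ T → P T ⇔ Q (rotT T)) →
      HasExactly n P → HasExactly n Q
    HasExactly-rotT {Q = Q} P⇔Q = HasExactly-transport rotT (λ T → rotT (rotT T)) rotT³ rotT³
      (λ T → to (P⇔Q T)) (λ T q → from (P⇔Q (rotT (rotT T))) (subst Q (sym (rotT³ T)) q))

    OnSideBary : Fin 3 → SmallTri → Set
    OnSideBary i T = OnSide k l i (bary3 T)

    OnSideBary-rot : ∀ i T → OnSideBary i T → OnSideBary (next i) (rotT T)
    OnSideBary-rot i T h = subst (OnSide k l (next i)) (sym (bary3-rotT T)) (OnSide-rotP i h)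

    OnSideBary-rot⇔ : ∀ i T → OnSideBary i T ⇔ OnSideBary (next i) (rotT T)
    OnSideBary-rot⇔ i T = mk⇔ (OnSideBary-rot i T) (reflect OnSideBary OnSideBary-rot i T)

    UpOnSide-rot⇔ : ∀ i T → (IsUp T × OnSideBary i T) ⇔ (IsUp (rotT T) × OnSideBary (next i) (rotT T))
    UpOnSide-rot⇔ i (up a b) =
      mk⇔ (λ (u , h) → u , OnSideBary-rot i (up a b) h) (λ (u , h) → u , from (OnSideBary-rot⇔ i (up a b)) h)
    UpOnSide-rot⇔ i (down a b) = mk⇔ (λ ()) (λ ())

    InnerNeighbour : SmallTri → SmallTri → Set
    InnerNeighbour T S = EdgeAdjacent T S × InTri k l (bary3 S)

    InnerNeighbour-rot : ∀ {T S} → InnerNeighbour T S → InnerNeighbour (rotT T) (rotT S)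
    InnerNeighbour-rot {S = S} (adjacent , inside) =
      EdgeAdjacent-rot adjacent , subst (InTri k l) (sym (bary3-rotT S)) (InTri-rotP inside)

    InnerNeighbour-rot⇔ : ∀ T S → InnerNeighbour T S ⇔ InnerNeighbour (rotT T) (rotT S)
    InnerNeighbour-rot⇔ T S = mk⇔ InnerNeighbour-rot
      (λ h → subst₂ InnerNeighbour (rotT³ T) (rotT³ S) (InnerNeighbour-rot (InnerNeighbour-rot h)))

    SideCounts : ℕ → Fin 3 → Set
    SideCounts m i = HasExactly (2 ℕ.* m) (OnSideBary i) × HasExactly m (λ T → IsUp T × OnSideBary i T) ×
                     (∀ T → IsUp T → OnSideBary i T → HasExactly 2 (InnerNeighbour T))

    SideCounts-rot : ∀ {m} i → SideCounts m i → SideCounts m (next i)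
    SideCounts-rot i (all , ups , neighbours) =
      HasExactly-rotT (OnSideBary-rot⇔ i) all , HasExactly-rotT (UpOnSide-rot⇔ i) ups , neighbours′
      where
      neighbours′ : ∀ T → IsUp T → OnSideBary (next i) T → HasExactly 2 (InnerNeighbour T)
      neighbours′ T u h = subst (λ T → HasExactly 2 (InnerNeighbour T)) (rotT³ T)
        (HasExactly-rotT (InnerNeighbour-rot⇔ T′) (neighbours T′ (proj₁ up-on-side) (proj₂ up-on-side)))
        where
        T′ : SmallTri
        T′ = rotT (rotT T)
        up-on-side : IsUp T′ × OnSideBary i T′
        up-on-side = from (UpOnSide-rot⇔ i T′)
          (subst (λ S → IsUp S × OnSideBary (next i) S) (sym (rotT³ T)) (u , h))

    exists-rot : ∀ i → Σ SmallTri (OnSideBary i) → Σ SmallTri (OnSideBary (next i))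
    exists-rot i (T , h) = rotT T , OnSideBary-rot i T h

    UpBaryOnBoundary-rot : ∀ {P} → UpBaryOnBoundary k l P → UpBaryOnBoundary k l (rot3 k l P)
    UpBaryOnBoundary-rot {P} (T , u , refl , i , h) =
      rotT T , IsUp-rot T u , trans (bary3-rotT T) (sym (rot3≡rotP P)) , next i ,
      subst (OnSide k l (next i)) (sym (rot3≡rotP P)) (OnSide-rotP i h)

    UpBaryOnBoundary-rot⇔ : ∀ P → UpBaryOnBoundary k l P ⇔ UpBaryOnBoundary k l (rot3 k l P)
    UpBaryOnBoundary-rot⇔ P = mk⇔ UpBaryOnBoundary-rot
      (λ h → subst (UpBaryOnBoundary k l) rot3³ (UpBaryOnBoundary-rot (UpBaryOnBoundary-rot h)))
      where
      rot3³ : rot3 k l (rot3 k l (rot3 k l P)) ≡ P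
      rot3³ = trans (cong (λ Q → rot3 k l (rot3 k l Q)) (rot3≡rotP P))
                (trans (cong (rot3 k l) (rot3≡rotP (rotP P))) (trans (rot3≡rotP (rotP (rotP P))) (rotP³ P)))

-- The base of △

module _ where
  open import Data.Nat using (_+_; _*_; _∸_; _<_; _≤_; _%_; _/_)
  open import Data.List.Relation.Unary.All using ([]; _∷_)
  open import Data.List.Relation.Unary.AllPairs using ([]; _∷_)

  side₁-height : ∀ {k l P} → OnSide k l (suc zero) P → + 3 ℤ.* + l ℤ.≤ proj₂ P
  side₁-height {k} {l} {p₁ , p₂} (n , s , 0<n , _ , eq) =
    ℤ.0≤i-j⇒j≤i (subst (0ℤ ℤ.≤_) (sym (proj₁ (proj₂ (positive-multiple⇒ℕ 0<n scaled)))) (+≤+ z≤n))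
    where
    rise : ∀ K L → + 3 ℤ.* (+ 0 ℤ.* L ℤ.+ + 1 ℤ.* K ℤ.+ + 1 ℤ.* L) ℤ.- + 3 ℤ.* L ≡ + 3 ℤ.* K
    rise = solve-∀
    scaled : + n ℤ.* (p₂ ℤ.- + 3 ℤ.* + l) ≡ + (s * (3 * k))
    scaled = trans (cong proj₂ eq)
      (trans (cong (+ s ℤ.*_) (trans (rise (+ k) (+ l)) (sym (ℤ.pos-* 3 k)))) (sym (ℤ.pos-* s (3 * k))))

  module Side₀ {k l k₁ l₁ m : ℕ} (k≡ : k ≡ k₁ * m) (l≡ : l ≡ l₁ * m) (coprime : Coprime k₁ l₁)
               (0<l₁ : 0 < l₁) (l₁<k₁ : l₁ < k₁) (0<m : 0 < m) where

    OnBase : SmallTri → Set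
    OnBase T = OnSide k l zero (bary3 T)

    point : ℕ → ℤω
    point = ray k₁ l₁

    corner₁≡point : corner3 k l (suc zero) ≡ point (3 * m)
    corner₁≡point = cong₂ _,_ (scaled k≡) (scaled l≡)
      where
      scaled : ∀ {x y} → y ≡ x * m → + 3 ℤ.* + y ≡ + (3 * m * x)
      scaled {x} refl =
        trans (sym (ℤ.pos-* 3 (x * m))) (cong +_ (trans (cong (3 *_) (ℕ.*-comm x m)) (sym (ℕ.*-assoc 3 m x))))

    on-base⇔ : ∀ {P} → OnSide k l zero P ⇔ (Σ ℕ λ j → j ≤ 3 * m × P ≡ point j)
    on-base⇔ {P} = subst (λ B → OnSegment 0ω B P ⇔ (Σ ℕ λ j → j ≤ 3 * m × P ≡ point j))
      (sym corner₁≡point) (OnSegment-ray coprime (ℕ.<-trans 0<l₁ l₁<k₁) (ℕ.*-monoʳ-< 3 0<m))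

    Condition : Set
    Condition = k₁ % 3 ≢ 0 × k₁ % 3 ≡ l₁ % 3

    [3*m]%3≡0 : (3 * m) % 3 ≡ 0
    [3*m]%3≡0 = trans (cong (_% 3) (ℕ.*-comm 3 m)) (m*n%n≡0 m 3)

    index-nonzero : ∀ {T j} → bary3 T ≡ point j → j % 3 ≢ 0
    index-nonzero {T} {j} bary≡ j≡0 =
      proj₁ (bary3-residues {T} bary≡) (trans (sym (%3-absorbˡ j k₁)) (cong (λ r → (r * k₁) % 3) j≡0))

    base-interior : ∀ {T} → OnBase T → Σ ℕ λ j → 0 < j × j < 3 * m × bary3 T ≡ point j
    base-interior {T} h = interior (to on-base⇔ h)
      where
      interior : (Σ ℕ λ j → j ≤ 3 * m × bary3 T ≡ point j) →
                 Σ ℕ λ j → 0 < j × j < 3 * m × bary3 T ≡ point j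
      interior (j , j≤3m , bary≡) =
        j , ℕ.n≢0⇒n>0 (λ j≡0 → index-nonzero {T} {j} bary≡ (cong (_% 3) j≡0)) ,
        ℕ.≤∧≢⇒< j≤3m (λ j≡3m → index-nonzero {T} {j} bary≡ (trans (cong (_% 3) j≡3m) [3*m]%3≡0)) ,
        bary≡

    condition : ∀ {T} → OnBase T → Condition
    condition {T} h = at-index (to on-base⇔ h)
      where
      at-index : (Σ ℕ λ j → j ≤ 3 * m × bary3 T ≡ point j) → Condition
      at-index (j , _ , bary≡) =
        k₁≢0 , trans (%3-swap {k₁} {l₁ * j} {j} j≢0
                       (subst₂ (λ u v → u % 3 ≡ v % 3) (ℕ.*-comm j k₁) (ℕ.*-comm j l₁) (proj₂ residues)))
                     (*-square-%3 l₁ j j≢0)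
        where
        residues : (j * k₁) % 3 ≢ 0 × (j * k₁) % 3 ≡ (j * l₁) % 3
        residues = bary3-residues {T} {j * k₁} {j * l₁} bary≡
        j≢0 : j % 3 ≢ 0
        j≢0 = index-nonzero {T} {j} bary≡
        k₁≢0 : k₁ % 3 ≢ 0
        k₁≢0 k₁≡0 = proj₁ residues (trans (*-%3-congʳ j k₁≡0) (cong (_% 3) (ℕ.*-zeroʳ j)))

    base-off-side₁ : ∀ {T} → OnBase T → ¬ OnSide k l (suc zero) (bary3 T)
    base-off-side₁ {T} h on-side₁ = below-side₁ (base-interior {T} h)
      where
      3l≡ : + (3 * m * l₁) ≡ + 3 ℤ.* + l
      3l≡ = trans (cong +_ (trans (ℕ.*-assoc 3 m l₁) (cong (3 *_) (trans (ℕ.*-comm m l₁) (sym l≡)))))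
                  (ℤ.pos-* 3 l)
      below-side₁ : (Σ ℕ λ j → 0 < j × j < 3 * m × bary3 T ≡ point j) → ⊥
      below-side₁ (j , _ , j<3m , bary≡) =
        ℤ.<⇒≱ (subst₂ ℤ._<_ (cong proj₂ (sym bary≡)) 3l≡ (+<+ (ℕ.*-monoˡ-< l₁ {{ℕ.>-nonZero 0<l₁}} j<3m)))
              (side₁-height {k} {l} {bary3 T} on-side₁)

    module Corners (J R : ℤ) (T≡ : + (3 * m) ≡ J ℤ.+ R) where

      corner₁≡ : corner3 k l (suc zero) ≡ ((J ℤ.+ R) ℤ.* + k₁ , (J ℤ.+ R) ℤ.* + l₁)
      corner₁≡ = trans corner₁≡point (cong₂ _,_ (trans (ℤ.pos-* (3 * m) k₁) (cong (ℤ._* + k₁) T≡))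
                                                (trans (ℤ.pos-* (3 * m) l₁) (cong (ℤ._* + l₁) T≡)))

      corner₂≡ : corner3 k l (suc (suc zero)) ≡ (ℤ.- ((J ℤ.+ R) ℤ.* + l₁) , (J ℤ.+ R) ℤ.* (+ k₁ ℤ.+ + l₁))
      corner₂≡ = cong₂ _,_ (trans (turn₁ (+ k) (+ l)) (cong ℤ.-_ (cong proj₂ corner₁≡)))
        (trans (turn₂ (+ k) (+ l)) (trans (cong₂ ℤ._+_ (cong proj₁ corner₁≡) (cong proj₂ corner₁≡))
                                           (sym (ℤ.*-distribˡ-+ (J ℤ.+ R) (+ k₁) (+ l₁)))))
        where
        turn₁ : ∀ K L → + 3 ℤ.* (+ 0 ℤ.* K ℤ.- + 1 ℤ.* L) ≡ ℤ.- (+ 3 ℤ.* L)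
        turn₁ = solve-∀
        turn₂ : ∀ K L → + 3 ℤ.* (+ 0 ℤ.* L ℤ.+ + 1 ℤ.* K ℤ.+ + 1 ℤ.* L) ≡ + 3 ℤ.* K ℤ.+ + 3 ℤ.* L
        turn₂ = solve-∀

      InTri≡ : ∀ {P} → InTri k l P ≡ InTriangle 0ω ((J ℤ.+ R) ℤ.* + k₁ , (J ℤ.+ R) ℤ.* + l₁)
                                         (ℤ.- ((J ℤ.+ R) ℤ.* + l₁) , (J ℤ.+ R) ℤ.* (+ k₁ ℤ.+ + l₁)) P
      InTri≡ {P} = cong₂ (λ B C → InTriangle 0ω B C P) corner₁≡ corner₂≡

    neighbours : ∀ {a b j} → 0 < j → j < 3 * m → bary3 (up a b) ≡ point j →
      HasExactly 2 (λ S → EdgeAdjacent (up a b) S × InTri k l (bary3 S))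
    neighbours {a} {b} {j} 0<j j<3m bary≡ =
      down (a ℤ.+ + 1) b ∷ down a b ∷ [] , refl , ((λ eq → i+1≢i a (cong anchor₁ eq)) ∷ []) ∷ [] ∷ [] ,
      λ S → mk⇔ (listed S) (unlisted S)
      where
      J R K L : ℤ
      J = + j
      R = + (3 * m ∸ j)
      K = + k₁
      L = + l₁
      T≡ : + (3 * m) ≡ J ℤ.+ R
      T≡ = trans (cong +_ (sym (ℕ.m+[n∸m]≡n (ℕ.<⇒≤ j<3m)))) (ℤ.pos-+ j _)
      open Corners J R T≡
      open RayTriangle {J} {R} {K} {L} (+≤+ 0<j) (+≤+ (ℕ.m<n⇒0<n∸m j<3m))
        (+≤+ (ℕ.≤-trans (s≤s 0<l₁) l₁<k₁)) (+≤+ 0<l₁) (+≤+ (ℕ.<⇒≤ l₁<k₁))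
      centre : bary3 (up a b) ≡ (J ℤ.* K , J ℤ.* L)
      centre = trans bary≡ (cong₂ _,_ (ℤ.pos-* j k₁) (ℤ.pos-* j l₁))
      shifted : ∀ {S δ} → bary3 S ≡ bary3 (up a b) +ω δ → bary3 S ≡ (J ℤ.* K , J ℤ.* L) +ω δ
      shifted {δ = δ} eq = trans eq (cong (_+ω δ) centre)
      right : InTri k l (bary3 (down (a ℤ.+ + 1) b))
      right = subst (InTri k l) (sym (shifted {down (a ℤ.+ + 1) b} (bary3-right-of-up a b)))
        (subst id (sym (InTri≡ {(J ℤ.* K , J ℤ.* L) +ω (+ 1 , + 1)})) inside-right)
      left : InTri k l (bary3 (down a b))
      left = subst (InTri k l) (sym (shifted {down a b} (bary3-left-of-up a b)))
        (subst id (sym (InTri≡ {(J ℤ.* K , J ℤ.* L) +ω (ℤ.- + 2 , + 1)})) inside-left)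
      below : ¬ InTri k l (bary3 (down (a ℤ.+ + 1) (b ℤ.- + 1)))
      below inside = outside-below (subst id (InTri≡ {(J ℤ.* K , J ℤ.* L) +ω (+ 1 , ℤ.- + 2)})
        (subst (InTri k l) (shifted {down (a ℤ.+ + 1) (b ℤ.- + 1)} (bary3-below-up a b)) inside))
      anchor₁ : SmallTri → ℤ
      anchor₁ T = proj₁ (anchor T)
      shares-right : EdgeAdjacent (up a b) (down (a ℤ.+ + 1) b)
      shares-right = (λ ()) , (a ℤ.+ + 1 , b) , (a , b ℤ.+ + 1) , (λ eq → i+1≢i a (cong proj₁ eq)) ,
        (suc zero , refl) , (suc (suc zero) , refl) , (zero , refl) ,
        (suc (suc zero) , cong (_, b ℤ.+ + 1) (cancel a))
        where
        cancel : ∀ a → a ℤ.+ + 1 ℤ.- + 1 ≡ a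
        cancel = solve-∀
      shares-left : EdgeAdjacent (up a b) (down a b)
      shares-left = (λ ()) , (a , b) , (a , b ℤ.+ + 1) , (λ eq → i+1≢i b (sym (cong proj₂ eq))) ,
        (zero , refl) , (suc (suc zero) , refl) , (zero , refl) , (suc zero , refl)
      listed : ∀ S → S ∈ down (a ℤ.+ + 1) b ∷ down a b ∷ [] →
               EdgeAdjacent (up a b) S × InTri k l (bary3 S)
      listed S (here refl) = shares-right , right
      listed S (there (here refl)) = shares-left , left
      unlisted : ∀ S → EdgeAdjacent (up a b) S × InTri k l (bary3 S) →
                 S ∈ down (a ℤ.+ + 1) b ∷ down a b ∷ []
      unlisted S (adjacent , inside) = place (▲-neighbours adjacent) inside
        where
        place : ∀ {S} → Neighbour a b S → InTri k l (bary3 S) → S ∈ down (a ℤ.+ + 1) b ∷ down a b ∷ []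
        place (inj₁ refl) _ = here refl
        place (inj₂ (inj₁ refl)) _ = there (here refl)
        place (inj₂ (inj₂ refl)) inside = ⊥-elim (below inside)

    up-neighbours : ∀ T → IsUp T → OnBase T → HasExactly 2 (λ S → EdgeAdjacent T S × InTri k l (bary3 S))
    up-neighbours (up a b) _ h = at-index (base-interior {up a b} h)
      where
      at-index : (Σ ℕ λ j → 0 < j × j < 3 * m × bary3 (up a b) ≡ point j) →
                 HasExactly 2 (λ S → EdgeAdjacent (up a b) S × InTri k l (bary3 S))
      at-index (j , 0<j , j<3m , bary≡) = neighbours 0<j j<3m bary≡

    module _ (condition : Condition) where

      private
        k₁≢0 : k₁ % 3 ≢ 0
        k₁≢0 = proj₁ condition

      line-residues : ∀ {ρ} j → ρ < 3 → j % 3 ≡ (ρ * k₁) % 3 → Residues ρ (j * k₁) (j * l₁)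
      line-residues {ρ} j ρ<3 j≡ = jk₁≡ρ , trans (*-%3-congʳ j (sym (proj₂ condition))) jk₁≡ρ
        where
        jk₁≡ρ : (j * k₁) % 3 ≡ ρ
        jk₁≡ρ = trans (sym (%3-swap {ρ} {j} {k₁} k₁≢0 (sym j≡))) (m<n⇒m%n≡m ρ<3)

      line-index : ∀ {ρ} j → ρ < 3 → Residues ρ (j * k₁) (j * l₁) → j % 3 ≡ (ρ * k₁) % 3
      line-index {ρ} j ρ<3 (jk₁≡ρ , _) = %3-swap {j} {ρ} {k₁} k₁≢0 (trans jk₁≡ρ (sym (m<n⇒m%n≡m ρ<3)))

      -- The triangles of shape Is on the base are those with barycentre j•(k₁ , l₁), j k₁ ≡ ρ (mod 3),
      -- i.e. j ≡ ρ k₁, enumerated as j = 3 s + c for s < m.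
      module Count (ρ : ℕ) (ρ<3 : ρ < 3) (ρ≢0 : ρ ≢ 0) (Is : SmallTri → Set) (F : ℕ → ℕ → SmallTri)
        (Is-F : ∀ X Y → Is (F X Y))
        (bary3-F : ∀ {X Y} → Residues ρ X Y → bary3 (F X Y) ≡ (+ X , + Y))
        (F-by-bary3 : ∀ {T X Y} → Is T → bary3 T ≡ (+ X , + Y) → T ≡ F X Y × Residues ρ X Y) where

        c : ℕ
        c = (ρ * k₁) % 3

        c<3 : c < 3
        c<3 = m%n<n (ρ * k₁) 3

        c≢0 : c ≢ 0
        c≢0 c≡0 = ρ≢0 (trans (sym (m<n⇒m%n≡m ρ<3)) (%3-swap {ρ} {0} {k₁} k₁≢0 c≡0))

        index : ℕ → ℕ
        index s = 3 * s + c

        triangle : ℕ → SmallTri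
        triangle s = F (index s * k₁) (index s * l₁)

        bary3-triangle : ∀ s → bary3 (triangle s) ≡ point (index s)
        bary3-triangle s =
          bary3-F {index s * k₁} {index s * l₁} (line-residues (index s) ρ<3 ([3*s+c]%3≡c s c<3))

        triangle-injective : ∀ {s t} → triangle s ≡ triangle t → s ≡ t
        triangle-injective {s} {t} eq =
          ℕ.*-cancelˡ-≡ s t 3 (ℕ.+-cancelʳ-≡ c (3 * s) (3 * t)
            (ℕ.*-cancelʳ-≡ (index s) (index t) k₁ {{ℕ.>-nonZero (ℕ.<-trans 0<l₁ l₁<k₁)}}
              (ℤ.+-injective (cong proj₁ (trans (sym (bary3-triangle s)) (trans (cong bary3 eq) (bary3-triangle t)))))))

        image⇔ : ∀ T → (Σ ℕ λ s → s < m × triangle s ≡ T) ⇔ (Is T × OnBase T)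
        image⇔ T = mk⇔ on-base (λ (is , h) → in-image is h)
          where
          on-base : (Σ ℕ λ s → s < m × triangle s ≡ T) → Is T × OnBase T
          on-base (s , s<m , refl) =
            Is-F _ _ , from on-base⇔ (index s , ℕ.<⇒≤ (from (3*s+c<3*m⇔s<m c<3) s<m) , bary3-triangle s)
          in-image : Is T → OnBase T → Σ ℕ λ s → s < m × triangle s ≡ T
          in-image is h = at-index (to on-base⇔ h)
            where
            at-index : (Σ ℕ λ j → j ≤ 3 * m × bary3 T ≡ point j) → Σ ℕ λ s → s < m × triangle s ≡ T
            at-index (j , j≤3m , bary≡) =
              j / 3 , to (3*s+c<3*m⇔s<m c<3) (subst (_< 3 * m) j≡ j<3m) ,
              trans (cong (λ i → F (i * k₁) (i * l₁)) (sym j≡)) (sym (proj₁ recognised))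
              where
              recognised : T ≡ F (j * k₁) (j * l₁) × Residues ρ (j * k₁) (j * l₁)
              recognised = F-by-bary3 {T} {j * k₁} {j * l₁} is bary≡
              j%3≡c : j % 3 ≡ c
              j%3≡c = line-index j ρ<3 (proj₂ recognised)
              j≡ : j ≡ index (j / 3)
              j≡ = trans (m≡3*[m/3]+m%3 j) (cong (λ r → 3 * (j / 3) + r) j%3≡c)
              j<3m : j < 3 * m
              j<3m = ℕ.≤∧≢⇒< j≤3m λ j≡3m → c≢0 (trans (sym j%3≡c) (trans (cong (_% 3) j≡3m) [3*m]%3≡0))

        count : HasExactly m (λ T → Is T × OnBase T)
        count = HasExactly-cong image⇔ (HasExactly-image triangle triangle-injective m)

      module Up = Count 1 (s≤s (s≤s z≤n)) (λ ()) IsUp upAt (λ _ _ → tt) bary3-upAt up-by-bary3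
      module Down = Count 2 (s≤s (s≤s (s≤s z≤n))) (λ ()) IsDown downAt (λ _ _ → tt) bary3-downAt down-by-bary3

      up-count : HasExactly m (λ T → IsUp T × OnBase T)
      up-count = Up.count

      base-count : HasExactly (2 * m) OnBase
      base-count = subst (λ n → HasExactly n OnBase) (cong (λ n → m + n) (sym (ℕ.+-identityʳ m)))
        (HasExactly-cong (λ T → mk⇔ (forget T) (shaped T)) (HasExactly-⊎ up≢down Up.count Down.count))
        where
        forget : ∀ T → (IsUp T × OnBase T) ⊎ (IsDown T × OnBase T) → OnBase T
        forget T (inj₁ (_ , h)) = h
        forget T (inj₂ (_ , h)) = h
        shaped : ∀ T → OnBase T → (IsUp T × OnBase T) ⊎ (IsDown T × OnBase T)
        shaped (up a b) h = inj₁ (tt , h)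
        shaped (down a b) h = inj₂ (tt , h)
        up≢down : ∀ T → IsUp T × OnBase T → IsDown T × OnBase T → ⊥
        up≢down (up a b) _ (() , _)

      base-witness : Σ SmallTri OnBase
      base-witness = Up.triangle 0 , proj₂ (to (Up.image⇔ (Up.triangle 0)) (0 , 0<m , refl))

-- All three sides

module _ where
  open import Data.Nat using (_+_; _*_; _<_)

  module AllSides {k l k₁ l₁ m : ℕ} (k≡ : k ≡ k₁ * m) (l≡ : l ≡ l₁ * m) (coprime : Coprime k₁ l₁)
               (0<l₁ : 0 < l₁) (l₁<k₁ : l₁ < k₁) (0<m : 0 < m) where
    open Side₀ k≡ l≡ coprime 0<l₁ l₁<k₁ 0<m
    open Rotation k l

    existence : ∀ i → Σ SmallTri (OnSideBary i) ⇔ Condition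
    existence zero = mk⇔ (λ (T , h) → condition {T} h) base-witness
    existence (suc zero) =
      mk⇔ (λ e → to (existence zero) (exists-rot (suc (suc zero)) (exists-rot (suc zero) e)))
          (λ c → exists-rot zero (from (existence zero) c))
    existence (suc (suc zero)) =
      mk⇔ (λ e → to (existence zero) (exists-rot (suc (suc zero)) e))
          (λ c → exists-rot (suc zero) (exists-rot zero (from (existence zero) c)))

    off-next-side : ∀ i T → OnSideBary i T → ¬ OnSideBary (next i) T
    off-next-side zero T = base-off-side₁ {T}
    off-next-side (suc zero) T h₁ h₂ = off-next-side zero (rotT (rotT T))
      (OnSideBary-rot (suc (suc zero)) (rotT T) (OnSideBary-rot (suc zero) T h₁))
      (OnSideBary-rot zero (rotT T) (OnSideBary-rot (suc (suc zero)) T h₂))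
    off-next-side (suc (suc zero)) T h₂ h₀ =
      off-next-side zero (rotT T) (OnSideBary-rot (suc (suc zero)) T h₂) (OnSideBary-rot zero T h₀)

    module _ (cond : Condition) where

      side-counts₀ : SideCounts m zero
      side-counts₀ = base-count cond , up-count cond , up-neighbours

      side-counts : ∀ i → SideCounts m i
      side-counts zero = side-counts₀
      side-counts (suc zero) = SideCounts-rot zero side-counts₀
      side-counts (suc (suc zero)) = SideCounts-rot (suc zero) (SideCounts-rot zero side-counts₀)

      UpOnSide : Fin 3 → SmallTri → Set
      UpOnSide i T = IsUp T × OnSideBary i T

      UpOnSomeSide : SmallTri → Set
      UpOnSomeSide T = UpOnSide zero T ⊎ (UpOnSide (suc zero) T ⊎ UpOnSide (suc (suc zero)) T)

      boundary-up-count : HasExactly (3 * m) (λ T → IsUp T × Σ (Fin 3) (λ i → OnSideBary i T))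
      boundary-up-count = subst (λ n → HasExactly n (λ T → IsUp T × Σ (Fin 3) (λ i → OnSideBary i T)))
        (cong (λ n → m + (m + n)) (sym (ℕ.+-identityʳ m)))
        (HasExactly-cong regroup
          (HasExactly-⊎ apart₀ (ups zero) (HasExactly-⊎ apart₁ (ups (suc zero)) (ups (suc (suc zero))))))
        where
        ups : ∀ i → HasExactly m (UpOnSide i)
        ups i = proj₁ (proj₂ (side-counts i))
        apart₁ : ∀ T → UpOnSide (suc zero) T → ¬ UpOnSide (suc (suc zero)) T
        apart₁ T (_ , h₁) (_ , h₂) = off-next-side (suc zero) T h₁ h₂
        apart₀ : ∀ T → UpOnSide zero T → ¬ (UpOnSide (suc zero) T ⊎ UpOnSide (suc (suc zero)) T)
        apart₀ T (_ , h₀) (inj₁ (_ , h₁)) = off-next-side zero T h₀ h₁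
        apart₀ T (_ , h₀) (inj₂ (_ , h₂)) = off-next-side (suc (suc zero)) T h₂ h₀
        side-of : ∀ {T} → UpOnSomeSide T → IsUp T × Σ (Fin 3) (λ i → OnSideBary i T)
        side-of (inj₁ (u , h)) = u , zero , h
        side-of (inj₂ (inj₁ (u , h))) = u , suc zero , h
        side-of (inj₂ (inj₂ (u , h))) = u , suc (suc zero) , h
        on-side : ∀ {T} → IsUp T × Σ (Fin 3) (λ i → OnSideBary i T) → UpOnSomeSide T
        on-side (u , zero , h) = inj₁ (u , h)
        on-side (u , suc zero , h) = inj₂ (inj₁ (u , h))
        on-side (u , suc (suc zero) , h) = inj₂ (inj₂ (u , h))
        regroup : ∀ T → UpOnSomeSide T ⇔ (IsUp T × Σ (Fin 3) (λ i → OnSideBary i T))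
        regroup T = mk⇔ side-of on-side

open import Data.Nat using (_<_; _*_; _%_)

primitive-part : ∀ {k l k₁ l₁} → 0 < l → l < k → k ≡ k₁ * gcd k l → l ≡ l₁ * gcd k l →
  Coprime k₁ l₁ × 0 < l₁ × l₁ < k₁ × 0 < gcd k l
primitive-part {k} {l} {k₁} {l₁} 0<l l<k k≡ l≡ =
  coprime , 0<l₁ , ℕ.*-cancelʳ-< m l₁ k₁ (subst₂ _<_ l≡ k≡ l<k) , 0<m
  where
  open ≡-Reasoning
  m : ℕ
  m = gcd k l
  0<m : 0 < m
  0<m = ℕ.n≢0⇒n>0 (gcd[m,n]≢0 k l (inj₂ (ℕ.n>0⇒n≢0 0<l)))
  0<l₁ : 0 < l₁
  0<l₁ = ℕ.n≢0⇒n>0 λ l₁≡0 → ℕ.n>0⇒n≢0 0<l (trans l≡ (cong (_* m) l₁≡0))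
  coprime : Coprime k₁ l₁
  coprime = gcd≡1⇒coprime (ℕ.*-cancelˡ-≡ (gcd k₁ l₁) 1 m {{ℕ.>-nonZero 0<m}} (begin
    m * gcd k₁ l₁         ≡⟨ c*gcd[m,n]≡gcd[cm,cn] m k₁ l₁ ⟩
    gcd (m * k₁) (m * l₁) ≡⟨ cong₂ gcd (trans (ℕ.*-comm m k₁) (sym k≡)) (trans (ℕ.*-comm m l₁) (sym l≡)) ⟩
    m                     ≡⟨ ℕ.*-identityʳ m ⟨
    m * 1                 ∎))

lemma2p4 : (k l : ℕ) → 0 < l → l < k →
    (k₁ l₁ : ℕ) → k ≡ k₁ * gcd k l → l ≡ l₁ * gcd k l →
    ((i : Fin 3) →
      (Σ SmallTri (λ T → OnSide k l i (bary3 T)))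
        ⇔ (k₁ % 3 ≢ 0 × k₁ % 3 ≡ l₁ % 3))
    × (k₁ % 3 ≢ 0 → k₁ % 3 ≡ l₁ % 3 →
      ((i : Fin 3) →
        HasExactly (2 * gcd k l) (λ T → OnSide k l i (bary3 T))
        × HasExactly (gcd k l) (λ T → IsUp T × OnSide k l i (bary3 T))
        × ((T : SmallTri) → IsUp T → OnSide k l i (bary3 T) →
            HasExactly 2 (λ S → EdgeAdjacent T S × InTri k l (bary3 S))))
      × HasExactly (3 * gcd k l) (λ T → IsUp T × Σ (Fin 3) (λ i → OnSide k l i (bary3 T)))
      × ((P : ℤω) → UpBaryOnBoundary k l P ⇔ UpBaryOnBoundary k l (rot3 k l P)))
lemma2p4 k l 0<l l<k k₁ l₁ k≡ l≡ =
  existence , λ k₁≢0 k₁≡l₁ →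
    side-counts (k₁≢0 , k₁≡l₁) , boundary-up-count (k₁≢0 , k₁≡l₁) , UpBaryOnBoundary-rot⇔
  where
  reduced : Coprime k₁ l₁ × 0 < l₁ × l₁ < k₁ × 0 < gcd k l
  reduced = primitive-part 0<l l<k k≡ l≡
  open AllSides {k} {l} {k₁} {l₁} {gcd k l} k≡ l≡
    (proj₁ reduced) (proj₁ (proj₂ reduced)) (proj₁ (proj₂ (proj₂ reduced))) (proj₂ (proj₂ (proj₂ reduced)))
  open Rotation k l
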